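{- Let $G$ be a tree. Then for all $n\in\mathbb{N}$, $n\ge1$, \[ \mathrm{Sz}(\Gamma^G_n) = 2\,W(\Gamma^G_n). \]
   Context: Let $G$ be a finite tree with vertex set $V$ and fix an orientation of each edge. For an oriented edge $e=(s,t)$ of $G$ define a bijection $e$ of the set $V^n$ of words of length $n$ over $V$ recursively: $e$ fixes the empty word, and for a letter $z\in V$ and a word $w$, $e(sw)=t\,e(w)$, $e(tw)=sw$, and $e(zw)=zw$ for $z\notin\{s,t\}$. The $n$-th Schreier graph $\Gamma^G_n$ is the multigraph with vertex set $V^n$ having, for each word $u\in V^n$ and each edge $e$ of $G$, one edge labelled $e$ joining $u$ and $e(u)$ (so fixed points give loops and orbits of size $2$ give pairs of parallel edges). The Wiener index $W(H)$ is the sum of graph distances over all unordered pairs of vertices of $H$. For adjacent vertices $u,v$, $n(u,v)$ is the number of vertices strictly closer to $u$ than to $v$, and the Szeged index is $\mathrm{Sz}(H)=\sum_{\{u,v\}\in E(H)} n(u,v)n(v,u)$, summed over all edges (parallel edges counted separately, loops contributing $0$). -}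

module Defs where

open import Data.Nat using (ℕ; zero; suc; _+_; _*_; _<ᵇ_)
open import Data.Fin using (Fin; _≟_)
open import Data.Bool using (Bool; true; false; if_then_else_; _∨_; _∧_; not)
open import Data.List using (List; []; _∷_; map; concatMap; allFin; length; filter; _++_)
open import Data.Bool.ListAction using (any)
open import Data.Nat.ListAction using (sum)
open import Data.List.Relation.Unary.Any using (Any)
open import Data.List.Relation.Unary.AllPairs using (AllPairs)
open import Data.List.Relation.Unary.All using (All)
open import Data.Vec using (Vec; []; _∷_)
import Data.Vec.Properties as VecP
open import Data.Product using (_×_; _,_; proj₁; proj₂)
open import Data.Sum using (_⊎_)
open import Relation.Nullary using (¬_; does)
open import Relation.Binary.PropositionalEquality using (_≡_; _≢_)
open import Relation.Binary.Construct.Closure.ReflexiveTransitive using (Star)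

-- The base graph G: vertex set V = Fin m, oriented edges given as a list
-- of ordered pairs (s , t) (the orientation of edge {s,t} is s → t).

OEdge : ℕ → Set
OEdge m = Fin m × Fin m

AdjG : ∀ {m} → List (OEdge m) → Fin m → Fin m → Set
AdjG E a b = Any (λ e → (proj₁ e ≡ a × proj₂ e ≡ b) ⊎ (proj₁ e ≡ b × proj₂ e ≡ a)) E

DistinctEdges : ∀ {m} → OEdge m → OEdge m → Set
DistinctEdges (s , t) (s' , t') = ¬ ((s ≡ s' × t ≡ t') ⊎ (s ≡ t' × t ≡ s'))

record IsTree (m : ℕ) (E : List (OEdge m)) : Set where
  field
    noLoops   : All (λ e → proj₁ e ≢ proj₂ e) E
    noMulti   : AllPairs DistinctEdges E
    connected : ∀ a b → Star (AdjG E) a b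
    edgeCount : length E + 1 ≡ m

Word : ℕ → ℕ → Set
Word m n = Vec (Fin m) n

act : ∀ {m n} → OEdge m → Word m n → Word m n
act e [] = []
act (s , t) (z ∷ w) with does (z ≟ s)
... | true = t ∷ act (s , t) w
... | false with does (z ≟ t)
...   | true  = s ∷ w
...   | false = z ∷ w

allWords : ∀ m n → List (Word m n)
allWords m zero    = [] ∷ []
allWords m (suc n) = concatMap (λ z → map (z ∷_) (allWords m n)) (allFin m)

_==_ : ∀ {m n} → Word m n → Word m n → Bool
u == v = does (VecP.≡-dec _≟_ u v)

-- The Schreier graph Γ_n: vertices V^n, one edge {u , e(u)} for every
-- word u and every edge e of G.

module Schreier {m : ℕ} (E : List (OEdge m)) (n : ℕ) where

  V : List (Word m n)
  V = allWords m n

  edges : List (Word m n × Word m n)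
  edges = concatMap (λ u → map (λ e → (u , act e u)) E) V

  adj : Word m n → Word m n → Bool
  adj x y = any (λ e → (act e x == y) ∨ (act e y == x)) E

  within : ℕ → Word m n → Word m n → Bool
  within zero    u v = u == v
  within (suc k) u v = within k u v ∨ any (λ x → adj u x ∧ within k x v) V

  -- least k < fuel with p k, and fuel if there is none
  least : ℕ → (ℕ → Bool) → ℕ
  least zero    p = zero
  least (suc f) p = if p zero then zero else suc (least f (λ k → p (suc k)))

  -- graph distance (Γ_n is finite, so any finite distance is < |V^n|)
  dist : Word m n → Word m n → ℕ
  dist u v = least (length V) (λ k → within k u v)

  pairs : ∀ {A : Set} → List A → List (A × A)
  pairs []       = []
  pairs (x ∷ xs) = map (x ,_) xs ++ pairs xs

  W : ℕ
  W = sum (map (λ p → dist (proj₁ p) (proj₂ p)) (pairs V))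

  nn : Word m n → Word m n → ℕ
  nn u v = length (filter (λ w → dist w u Data.Nat.<? dist w v) V)

  Sz : ℕ
  Sz = sum (map (λ p → nn (proj₁ p) (proj₂ p) * nn (proj₂ p) (proj₁ p)) edges)

module Submission where

-- Fix an edge e = (s , t) of G.  The e-orbit of a word consists of the words that differ from it
-- only in its maximal prefix of letters from {s , t}; e runs through it as a binary odometer, so
-- the Γ-edges labelled e form disjoint cycles of length 2ᵏ (loops for k = 0, double edges for k = 1).
-- Because G is a tree, every word y has on each such cycle a nearest point, its gate, and the gate
-- does not move when y moves along an edge outside that cycle.  Thus every Γ-edge {u , e u} cuts the
-- words into those whose gate lies on the half of the cycle at u and those whose gate lies on the
-- half at e u.  Moving x along an edge switches, of all these cuts, exactly the cut of that edge
-- and of its antipodal edge on the same cycle, so the number of cuts separating x from y changes by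
-- 2 along every edge that moves x; and if x ≠ y, it decreases along the cycle through x on which the
-- gate of y is not x.  Hence this number is 2 d(x , y).  As the cut of {u , v} is exactly the
-- partition into the words closer to u and those closer to v, n(u , v) n(v , u) counts the pairs
-- it separates, and summing over all edges gives Sz = Σ_{x , y} 2 d(x , y) = 2 W.

open import Defs
open import Data.Bool using (Bool; true; false; not; if_then_else_; _∨_; _∧_)
open import Data.Bool.ListAction using (any)
import Data.Bool.Properties as B
open import Data.Bool.Properties using (not-involutive; not-injective; T-≡; ∨-zeroʳ; ¬-not)
open import Data.Fin using (Fin; _≟_)
open import Data.List using (List; []; _∷_; map; concatMap; allFin; length; filter; _++_)
open import Data.List.Membership.Propositional using (_∈_; find)
open import Data.List.Membership.Propositional.Properties using (∈-allFin; ∈-map⁺; ∈-concatMap⁺; ∈-filter⁺)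
open import Data.List.Properties using (length-tabulate; filter-notAll)
open import Data.List.Relation.Unary.All as All using (All; []; _∷_)
open import Data.List.Relation.Unary.AllPairs as AllPairs using ([]; _∷_)
open import Data.List.Relation.Unary.Any as Any using (here; there)
open import Data.List.Relation.Unary.Any.Properties using (any⁺; any⁻)
open import Data.List.Relation.Unary.Unique.Propositional using (Unique)
open import Data.List.Relation.Unary.Unique.Propositional.Properties using (allFin⁺)
open import Data.Nat using (ℕ; zero; suc; _+_; _*_; _^_; _≤_; _<_; z≤n; s≤s; _<?_; _≤?_; >-nonZero)
open import Data.Nat.ListAction using (sum)
open import Data.Nat.Properties
  using ( +-assoc; +-comm; +-suc; +-identityʳ; +-commutativeSemigroup; *-comm; *-suc; *-zeroʳ
        ; *-identityˡ; *-identityʳ; *-distribˡ-+; *-distribʳ-+; suc-injective; m+1+n≢0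
        ; ≤-refl; ≤-reflexive; ≤-trans; ≤-pred; <-irrefl; <-asym; <-≤-trans; ≤-<-trans
        ; <⇒≤; <⇒≱; ≤⇒≯; ≰⇒>; ≤∧≢⇒<; >⇒≢; n≤1+n; n<1+n; n<1⇒n≡0; n≤0⇒n≡0; n≢0⇒n>0
        ; m≤m+n; m≤n+m; m<m+n; +-mono-≤; +-mono-<; +-monoˡ-≤; +-monoʳ-≤
        ; +-cancelʳ-≤; +-cancelʳ-<; +-cancelʳ-≡; module ≤-Reasoning )
  renaming (_≟_ to _≟ℕ_; m^n>0 to m^n>0′)
open import Algebra.Properties.CommutativeSemigroup +-commutativeSemigroup using (interchange)
open import Data.Product using (∃; _×_; _,_; proj₁; proj₂)
open import Data.Product.Properties using () renaming (≡-dec to ×-≡-dec)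
open import Data.Sum using (_⊎_; inj₁; inj₂; [_,_])
open import Data.Vec using ([]; _∷_; head; tail)
open import Data.Vec.Properties using (≡-dec; ∷-injective)
open import Function using (_∘_; id)
open import Function.Bundles using (Equivalence)
open import Relation.Binary.Construct.Closure.ReflexiveTransitive using (Star; ε; _◅_)
open import Relation.Binary.Definitions using (DecidableEquality)
open import Relation.Binary.PropositionalEquality
  using (_≡_; _≢_; refl; sym; trans; cong; cong₂; subst; subst₂; module ≡-Reasoning)
open import Relation.Nullary using (¬_; ¬?; Dec; yes; no; does; contradiction; _×-dec_; _⊎-dec_)
open import Relation.Nullary.Decidable using (dec-true; dec-false)

-- Finite sums and counting

∑ : ∀ {A : Set} → List A → (A → ℕ) → ℕ
∑ []       f = 0
∑ (x ∷ xs) f = f x + ∑ xs f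

syntax ∑ xs (λ x → b) = ∑[ x ∈ xs ] b

module _ {A : Set} where

  ∑-cong : ∀ xs {f g : A → ℕ} → (∀ {x} → x ∈ xs → f x ≡ g x) → ∑ xs f ≡ ∑ xs g
  ∑-cong []       eq = refl
  ∑-cong (x ∷ xs) eq = cong₂ _+_ (eq (here refl)) (∑-cong xs (eq ∘ there))

  ∑-mono-≤ : ∀ xs {f g : A → ℕ} → (∀ {x} → x ∈ xs → f x ≤ g x) → ∑ xs f ≤ ∑ xs g
  ∑-mono-≤ []       le = z≤n
  ∑-mono-≤ (x ∷ xs) le = +-mono-≤ (le (here refl)) (∑-mono-≤ xs (le ∘ there))

  ∑-zero : ∀ (xs : List A) → ∑[ x ∈ xs ] 0 ≡ 0
  ∑-zero []       = refl
  ∑-zero (x ∷ xs) = ∑-zero xs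

  ∑-const : ∀ (xs : List A) c → ∑[ x ∈ xs ] c ≡ length xs * c
  ∑-const []       c = refl
  ∑-const (x ∷ xs) c = cong (c +_) (∑-const xs c)

  ∑-+ : ∀ xs (f g : A → ℕ) → ∑[ x ∈ xs ] (f x + g x) ≡ ∑ xs f + ∑ xs g
  ∑-+ []       f g = refl
  ∑-+ (x ∷ xs) f g =
    trans (cong (f x + g x +_) (∑-+ xs f g)) (interchange (f x) (g x) (∑ xs f) (∑ xs g))

  ∑-*ˡ : ∀ xs c (f : A → ℕ) → ∑[ x ∈ xs ] (c * f x) ≡ c * ∑ xs f
  ∑-*ˡ []       c f = sym (*-zeroʳ c)
  ∑-*ˡ (x ∷ xs) c f = trans (cong (c * f x +_) (∑-*ˡ xs c f)) (sym (*-distribˡ-+ c (f x) _))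

  ∑-*ʳ : ∀ xs (f : A → ℕ) k → ∑[ x ∈ xs ] (f x * k) ≡ ∑ xs f * k
  ∑-*ʳ []       f k = refl
  ∑-*ʳ (x ∷ xs) f k = trans (cong (f x * k +_) (∑-*ʳ xs f k)) (sym (*-distribʳ-+ k (f x) (∑ xs f)))

  ∑-+-*ʳ : ∀ xs (f g : A → ℕ) k → ∑[ x ∈ xs ] (f x + g x * k) ≡ ∑ xs f + ∑ xs g * k
  ∑-+-*ʳ xs f g k = trans (∑-+ xs f (λ x → g x * k)) (cong (∑ xs f +_) (∑-*ʳ xs g k))

  ∑-++ : ∀ xs ys (f : A → ℕ) → ∑ (xs ++ ys) f ≡ ∑ xs f + ∑ ys f
  ∑-++ []       ys f = refl
  ∑-++ (x ∷ xs) ys f = trans (cong (f x +_) (∑-++ xs ys f)) (sym (+-assoc (f x) _ _))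

  sum-map : ∀ (f : A → ℕ) xs → sum (map f xs) ≡ ∑ xs f
  sum-map f []       = refl
  sum-map f (x ∷ xs) = cong (f x +_) (sum-map f xs)

∑-map : ∀ {A B : Set} (g : A → B) xs (f : B → ℕ) → ∑ (map g xs) f ≡ ∑[ x ∈ xs ] f (g x)
∑-map g []       f = refl
∑-map g (x ∷ xs) f = cong (f (g x) +_) (∑-map g xs f)

∑-concatMap : ∀ {A B : Set} (g : A → List B) xs (f : B → ℕ) →
              ∑ (concatMap g xs) f ≡ ∑[ x ∈ xs ] ∑ (g x) f
∑-concatMap g []       f = refl
∑-concatMap g (x ∷ xs) f = trans (∑-++ (g x) _ f) (cong (∑ (g x) f +_) (∑-concatMap g xs f))

∑-swap : ∀ {A B : Set} (xs : List A) (ys : List B) (f : A → B → ℕ) →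
         ∑[ x ∈ xs ] ∑[ y ∈ ys ] f x y ≡ ∑[ y ∈ ys ] ∑[ x ∈ xs ] f x y
∑-swap []       ys f = sym (∑-zero ys)
∑-swap (x ∷ xs) ys f =
  trans (cong (∑ ys (f x) +_) (∑-swap xs ys f)) (sym (∑-+ ys (f x) (λ y → ∑[ x ∈ xs ] f x y)))

𝟙 : ∀ {P : Set} → Dec P → ℕ
𝟙 (yes _) = 1
𝟙 (no _)  = 0

𝟙-yes : ∀ {P : Set} (p? : Dec P) → P → 𝟙 p? ≡ 1
𝟙-yes (yes _) p = refl
𝟙-yes (no ¬p) p = contradiction p ¬p

𝟙-no : ∀ {P : Set} (p? : Dec P) → ¬ P → 𝟙 p? ≡ 0
𝟙-no (yes p) ¬p = contradiction p ¬p
𝟙-no (no _)  ¬p = refl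

𝟙-⊎ : ∀ {P Q : Set} (p? : Dec P) (q? : Dec Q) → ¬ (P × Q) → 𝟙 (p? ⊎-dec q?) ≡ 𝟙 p? + 𝟙 q?
𝟙-⊎ (yes p) (yes q) ¬both = contradiction (p , q) ¬both
𝟙-⊎ (yes _) (no _)  _     = refl
𝟙-⊎ (no _)  (yes _) _     = refl
𝟙-⊎ (no _)  (no _)  _     = refl

length-filter-∑ : ∀ {A : Set} {P : A → Set} (P? : ∀ x → Dec (P x)) xs →
                  length (filter P? xs) ≡ ∑[ x ∈ xs ] 𝟙 (P? x)
length-filter-∑ P? []       = refl
length-filter-∑ P? (x ∷ xs) with P? x
... | yes _ = cong suc (length-filter-∑ P? xs)
... | no _  = length-filter-∑ P? xs

module _ {A : Set} (_≟ᴬ_ : DecidableEquality A) where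

  ∑-𝟙-absent : ∀ {x ys} → All (x ≢_) ys → ∑[ y ∈ ys ] 𝟙 (y ≟ᴬ x) ≡ 0
  ∑-𝟙-absent []         = refl
  ∑-𝟙-absent (x≢y ∷ ps) = cong₂ _+_ (𝟙-no _ (x≢y ∘ sym)) (∑-𝟙-absent ps)

  ∑-𝟙-unique : ∀ {x xs} → Unique xs → x ∈ xs → ∑[ y ∈ xs ] 𝟙 (y ≟ᴬ x) ≡ 1
  ∑-𝟙-unique (ps ∷ _)  (here refl) = cong₂ _+_ (𝟙-yes _ refl) (∑-𝟙-absent ps)
  ∑-𝟙-unique (ps ∷ qs) (there x∈) =
    cong₂ _+_ (𝟙-no _ (λ { refl → All.lookup ps x∈ refl })) (∑-𝟙-unique qs x∈)

∑-𝟙-allFin : ∀ {m} (a : Fin m) → ∑[ b ∈ allFin m ] 𝟙 (b ≟ a) ≡ 1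
∑-𝟙-allFin {m} a = ∑-𝟙-unique _≟_ (allFin⁺ m) (∈-allFin a)

length-as-∑ : ∀ {A : Set} (xs : List A) → length xs ≡ ∑[ x ∈ xs ] 1
length-as-∑ xs = sym (trans (∑-const xs 1) (*-identityʳ (length xs)))

module _ {m : ℕ} where

  _≟ʷ_ : ∀ {n} → DecidableEquality (Word m n)
  _≟ʷ_ = ≡-dec _≟_

  ∑-allWords : ∀ n (f : Word m (suc n) → ℕ) →
               ∑ (allWords m (suc n)) f ≡ ∑[ a ∈ allFin m ] ∑[ w ∈ allWords m n ] f (a ∷ w)
  ∑-allWords n f = trans (∑-concatMap _ (allFin m) f) (∑-cong (allFin m) (λ {a} _ → ∑-map (a ∷_) (allWords m n) f))

  ∈-allWords : ∀ {n} (u : Word m n) → u ∈ allWords m n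
  ∈-allWords []      = here refl
  ∈-allWords (a ∷ w) =
    ∈-concatMap⁺ _ (Any.map (λ { refl → ∈-map⁺ (a ∷_) (∈-allWords w) }) (∈-allFin a))

  length-allWords : ∀ n → length (allWords m n) ≡ m ^ n
  length-allWords zero    = refl
  length-allWords (suc n) = begin
    length (allWords m (suc n))                 ≡⟨ length-as-∑ (allWords m (suc n)) ⟩
    ∑[ u ∈ allWords m (suc n) ] 1               ≡⟨ ∑-allWords n (λ _ → 1) ⟩
    ∑[ a ∈ allFin m ] ∑[ w ∈ allWords m n ] 1    ≡⟨ ∑-cong (allFin m) (λ _ → length-as-∑ (allWords m n)) ⟨
    ∑[ a ∈ allFin m ] length (allWords m n)     ≡⟨ ∑-const (allFin m) _ ⟩
    length (allFin m) * length (allWords m n)   ≡⟨ cong₂ _*_ (length-tabulate {n = m} id) (length-allWords n) ⟩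
    m * m ^ n                                   ∎
    where open ≡-Reasoning

  𝟙-∷ : ∀ {n} (b a : Fin m) (w x : Word m n) → 𝟙 ((b ∷ w) ≟ʷ (a ∷ x)) ≡ 𝟙 (b ≟ a) * 𝟙 (w ≟ʷ x)
  𝟙-∷ b a w x with b ≟ a | w ≟ʷ x
  ... | yes refl | yes refl = refl
  ... | no _     | _        = refl
  ... | yes refl | no _     = refl

  ∑-𝟙-allWords : ∀ {n} (x : Word m n) → ∑[ u ∈ allWords m n ] 𝟙 (u ≟ʷ x) ≡ 1
  ∑-𝟙-allWords []               = refl
  ∑-𝟙-allWords {suc n} (a ∷ x) = begin
    ∑[ u ∈ allWords m (suc n) ] 𝟙 (u ≟ʷ (a ∷ x))
      ≡⟨ ∑-allWords n _ ⟩
    ∑[ b ∈ allFin m ] ∑[ w ∈ allWords m n ] 𝟙 ((b ∷ w) ≟ʷ (a ∷ x))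
      ≡⟨ ∑-cong (allFin m) (λ {b} _ → ∑-cong (allWords m n) (λ {w} _ → 𝟙-∷ b a w x)) ⟩
    ∑[ b ∈ allFin m ] ∑[ w ∈ allWords m n ] (𝟙 (b ≟ a) * 𝟙 (w ≟ʷ x))
      ≡⟨ ∑-cong (allFin m) (λ {b} _ → ∑-*ˡ (allWords m n) (𝟙 (b ≟ a)) _) ⟩
    ∑[ b ∈ allFin m ] (𝟙 (b ≟ a) * ∑[ w ∈ allWords m n ] 𝟙 (w ≟ʷ x))
      ≡⟨ ∑-cong (allFin m) (λ {b} _ → cong (𝟙 (b ≟ a) *_) (∑-𝟙-allWords x)) ⟩
    ∑[ b ∈ allFin m ] (𝟙 (b ≟ a) * 1)
      ≡⟨ ∑-cong (allFin m) (λ _ → *-identityʳ _) ⟩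
    ∑[ b ∈ allFin m ] 𝟙 (b ≟ a)
      ≡⟨ ∑-𝟙-allFin a ⟩
    1 ∎
    where open ≡-Reasoning

_≟ᵉ_ : ∀ {m} → DecidableEquality (OEdge m)
_≟ᵉ_ = ×-≡-dec _≟_ _≟_

does-not : ∀ {A B : Set} (a? : Dec A) (b? : Dec B) → (B → ¬ A) → (¬ A → B) → does b? ≡ not (does a?)
does-not (yes a) b? disjoint cover = dec-false b? (λ b → disjoint b a)
does-not (no ¬a) b? disjoint cover = dec-true b? (cover ¬a)

does-⇔ : ∀ {A B : Set} (a? : Dec A) (b? : Dec B) → (A → B) → (B → A) → does a? ≡ does b?
does-⇔ (yes a) b? to from = sym (dec-true b? (to a))
does-⇔ (no ¬a) b? to from = sym (dec-false b? (¬a ∘ from))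

from-does : ∀ {A : Set} (a? : Dec A) → does a? ≡ true → A
from-does (yes a) _ = a

module _ {A : Set} (p : A → Bool) where

  any-intro : ∀ {x xs} → x ∈ xs → p x ≡ true → any p xs ≡ true
  any-intro x∈ px = Equivalence.to T-≡ (any⁺ p (Any.map (λ { refl → Equivalence.from T-≡ px }) x∈))

  any-elim : ∀ xs → any p xs ≡ true → ∃ λ x → x ∈ xs × p x ≡ true
  any-elim xs h = let x , x∈ , px = find (any⁻ p xs (Equivalence.from T-≡ h)) in x , x∈ , Equivalence.to T-≡ px

∧-elim : ∀ a {b} → a ∧ b ≡ true → a ≡ true × b ≡ true
∧-elim true {true} _ = refl , refl

∨-elim : ∀ a {b} → a ∨ b ≡ true → a ≡ true ⊎ b ≡ true
∨-elim true  _ = inj₁ refl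
∨-elim false h = inj₂ h

-- Arithmetic on a cycle of length 2L

double-injective : ∀ i j → i + i ≡ j + j → i ≡ j
double-injective zero    zero    eq = refl
double-injective (suc i) (suc j) eq =
  cong suc (double-injective i j (suc-injective (trans (sym (+-suc i i)) (trans (suc-injective eq) (+-suc j j)))))

odd≢double : ∀ i j → suc (i + i) ≢ j + j
odd≢double zero    (suc j) eq = contradiction (trans (suc-injective eq) (+-suc j j)) λ ()
odd≢double (suc i) (suc j) eq =
  odd≢double i j (suc-injective (trans (cong suc (sym (+-suc i i))) (trans (suc-injective eq) (+-suc j j))))

double-mono-< : ∀ {i j} → i < j → i + i < j + j
double-mono-< i<j = +-mono-< i<j i<j

odd<double : ∀ {i j} → i < j → suc (i + i) < j + j
odd<double {i} {j} i<j = subst (_≤ j + j) (cong suc (+-suc i i)) (+-mono-≤ i<j i<j)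

double-suc : ∀ k → suc k + suc k ≡ k + k + 2
double-suc k = trans (cong suc (+-suc k k)) (+-comm 2 (k + k))

differ : Bool → Bool → ℕ
differ true  true  = 0
differ true  false = 1
differ false true  = 1
differ false false = 0

differ-refl : ∀ b → differ b b ≡ 0
differ-refl true  = refl
differ-refl false = refl

differ≤1 : ∀ a b → differ a b ≤ 1
differ≤1 true  true  = z≤n
differ≤1 true  false = ≤-refl
differ≤1 false true  = ≤-refl
differ≤1 false false = z≤n

differ-not : ∀ a → differ (not a) true ≡ differ a false
differ-not true  = refl
differ-not false = refl

differ-sym : ∀ a b → differ a b ≡ differ b a
differ-sym true  true  = refl
differ-sym true  false = refl
differ-sym false true  = refl
differ-sym false false = refl

CyclicSuc : ℕ → ℕ → ℕ → Set
CyclicSuc N q q′ = (suc q < N × q′ ≡ suc q) ⊎ (suc q ≡ N × q′ ≡ 0)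

-- Ahead L p q: q is one of the L positions p + 1, …, p + L modulo 2L.
Ahead : ℕ → ℕ → ℕ → Set
Ahead L p q = (p < q × q ≤ p + L) ⊎ (q + L ≤ p)

ahead? : ∀ L p q → Dec (Ahead L p q)
ahead? L p q = (p <? q ×-dec q ≤? p + L) ⊎-dec (q + L ≤? p)

ahead : ℕ → ℕ → ℕ → Bool
ahead L p q = does (ahead? L p q)

Antipodal : ℕ → ℕ → ℕ → Set
Antipodal L p q = q ≡ p + L ⊎ p ≡ q + L

module _ {L : ℕ} (L>0 : 0 < L) where

  private
    p<p+L : ∀ p → p < p + L
    p<p+L p = m<m+n p L>0

  ¬Ahead-refl : ∀ p → ¬ Ahead L p p
  ¬Ahead-refl p (inj₁ (p<p , _)) = <-irrefl refl p<p
  ¬Ahead-refl p (inj₂ p+L≤p)     = <-irrefl refl (<-≤-trans (p<p+L p) p+L≤p)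

  Ahead-suc : ∀ {p p′} → CyclicSuc (L + L) p p′ → Ahead L p p′
  Ahead-suc {p} (inj₁ (_ , refl))  = inj₁ (n<1+n p , p<p+L p)
  Ahead-suc {p} (inj₂ (1+p≡2L , refl)) =
    inj₂ (≤-pred (subst (suc L ≤_) (sym 1+p≡2L) (subst (_≤ L + L) (+-comm L 1) (+-monoʳ-≤ L L>0))))

module _ {L : ℕ} where

  Ahead-+L : ∀ {p q} → p < L → q < L + L →
             (Ahead L (p + L) q → ¬ Ahead L p q) × (¬ Ahead L p q → Ahead L (p + L) q)
  Ahead-+L {p} {q} p<L q<2L = disjoint , cover
    where
    disjoint : Ahead L (p + L) q → ¬ Ahead L p q
    disjoint (inj₁ (p+L<q , _)) (inj₁ (_ , q≤p+L)) = <-irrefl refl (<-≤-trans p+L<q q≤p+L)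
    disjoint (inj₁ (p+L<q , _)) (inj₂ q+L≤p)       = <-irrefl refl (<-≤-trans p<L (≤-trans (m≤n+m L q) q+L≤p))
    disjoint (inj₂ q+L≤p+L)     (inj₁ (p<q , _))   = <-irrefl refl (<-≤-trans p<q (+-cancelʳ-≤ L q p q+L≤p+L))
    disjoint (inj₂ _)           (inj₂ q+L≤p)       = <-irrefl refl (<-≤-trans p<L (≤-trans (m≤n+m L q) q+L≤p))
    cover : ¬ Ahead L p q → Ahead L (p + L) q
    cover ¬a with q ≤? p
    ... | yes q≤p = inj₂ (+-monoˡ-≤ L q≤p)
    ... | no  q≰p = inj₁ (≰⇒> (λ q≤p+L → ¬a (inj₁ (≰⇒> q≰p , q≤p+L))) ,
                         ≤-trans (<⇒≤ q<2L) (+-monoˡ-≤ L (m≤n+m L p)))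

  ahead-antipode : ∀ {p p′ q} → p < L + L → p′ < L + L → q < L + L →
                   Antipodal L p p′ → ahead L p′ q ≡ not (ahead L p q)
  ahead-antipode {p} {p′} {q} p<2L p′<2L q<2L (inj₁ refl) =
    does-not (ahead? L p q) (ahead? L p′ q) (proj₁ +L) (proj₂ +L)
    where +L = Ahead-+L (+-cancelʳ-< L p L p′<2L) q<2L
  ahead-antipode {p} {p′} {q} p<2L p′<2L q<2L (inj₂ refl) =
    trans (sym (not-involutive _)) (cong not (sym
      (does-not (ahead? L p′ q) (ahead? L p q) (proj₁ +L) (proj₂ +L))))
    where +L = Ahead-+L (+-cancelʳ-< L p′ L p<2L) q<2L

  ahead-cong-suc : ∀ {p q q′} → p < L + L → CyclicSuc (L + L) q q′ →
                   q ≢ p → ¬ Antipodal L p q → ahead L p q ≡ ahead L p q′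
  ahead-cong-suc {p} {q} p<2L q↦q′ q≢p ¬antipodal =
    does-⇔ (ahead? L p q) (ahead? L p _) (forward q↦q′) (backward q↦q′)
    where
    q≢p+L : q ≢ p + L
    q≢p+L = ¬antipodal ∘ inj₁
    q+L≢p : q + L ≢ p
    q+L≢p = ¬antipodal ∘ inj₂ ∘ sym
    forward : ∀ {q′} → CyclicSuc (L + L) q q′ → Ahead L p q → Ahead L p q′
    forward (inj₁ (_ , refl)) (inj₁ (p<q , q≤p+L)) = inj₁ (≤-trans p<q (n≤1+n q) , ≤∧≢⇒< q≤p+L q≢p+L)
    forward (inj₁ (_ , refl)) (inj₂ q+L≤p)         = inj₂ (≤∧≢⇒< q+L≤p q+L≢p)
    forward (inj₂ (1+q≡2L , refl)) (inj₁ (_ , q≤p+L)) =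
      inj₂ (+-cancelʳ-≤ L L p (subst (_≤ p + L) 1+q≡2L (≤∧≢⇒< q≤p+L q≢p+L)))
    forward (inj₂ (_ , refl)) (inj₂ q+L≤p)          = inj₂ (≤-trans (m≤n+m L q) q+L≤p)
    backward : ∀ {q′} → CyclicSuc (L + L) q q′ → Ahead L p q′ → Ahead L p q
    backward (inj₁ (_ , refl)) (inj₁ (p<1+q , 1+q≤p+L)) =
      inj₁ (≤∧≢⇒< (≤-pred p<1+q) (q≢p ∘ sym) , <⇒≤ 1+q≤p+L)
    backward (inj₁ (_ , refl)) (inj₂ 1+q+L≤p)          = inj₂ (≤-trans (n≤1+n _) 1+q+L≤p)
    backward (inj₂ (1+q≡2L , refl)) (inj₂ L≤p) =
      inj₁ (≤∧≢⇒< (≤-pred (subst (suc p ≤_) (sym 1+q≡2L) p<2L)) (q≢p ∘ sym) ,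
            <⇒≤ (<-≤-trans (subst (q <_) 1+q≡2L (n<1+n q)) (+-monoˡ-≤ L L≤p)))

  Ahead-or-¬Ahead-pred : ∀ {p p⁻ q} → q < L + L → q ≢ p → CyclicSuc (L + L) p⁻ p →
                         Ahead L p q ⊎ ¬ Ahead L p⁻ q
  Ahead-or-¬Ahead-pred {p} {p⁻} {q} q<2L q≢p p⁻↦p with ahead? L p q
  ... | yes a = inj₁ a
  ... | no ¬a = inj₂ (¬a ∘ shift q≢p p⁻↦p)
    where
    shift : ∀ {p} → q ≢ p → CyclicSuc (L + L) p⁻ p → Ahead L p⁻ q → Ahead L p q
    shift q≢p (inj₁ (_ , refl)) (inj₁ (p⁻<q , q≤p⁻+L)) =
      inj₁ (≤∧≢⇒< p⁻<q (q≢p ∘ sym) , ≤-trans q≤p⁻+L (+-monoˡ-≤ L (n≤1+n p⁻)))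
    shift _ (inj₁ (_ , refl)) (inj₂ q+L≤p⁻) = inj₂ (≤-trans q+L≤p⁻ (n≤1+n p⁻))
    shift _ (inj₂ (1+p⁻≡2L , refl)) (inj₁ (p⁻<q , _)) =
      contradiction (≤-pred (subst (suc q ≤_) (sym 1+p⁻≡2L) q<2L)) (<⇒≱ p⁻<q)
    shift q≢p (inj₂ (1+p⁻≡2L , refl)) (inj₂ q+L≤p⁻) =
      inj₁ (≤∧≢⇒< z≤n (q≢p ∘ sym) ,
            <⇒≤ (+-cancelʳ-< L q L (subst (q + L <_) 1+p⁻≡2L (s≤s q+L≤p⁻))))

Antipodal-double : ∀ {L i j} → Antipodal L i j → Antipodal (L + L) (i + i) (j + j)
Antipodal-double {L} {i}         (inj₁ refl) = inj₁ (interchange i L i L)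
Antipodal-double {L} {j = j}     (inj₂ refl) = inj₂ (interchange j L j L)

Antipodal-odd : ∀ {L i j} → Antipodal L i j → Antipodal (L + L) (suc (i + i)) (suc (j + j))
Antipodal-odd {L} {i}     (inj₁ refl) = inj₁ (cong suc (interchange i L i L))
Antipodal-odd {L} {j = j} (inj₂ refl) = inj₂ (cong suc (interchange j L j L))

¬Antipodal-refl : ∀ {L p} → 0 < L → ¬ Antipodal L p p
¬Antipodal-refl {L} {p} L>0 (inj₁ p≡p+L) = <-irrefl p≡p+L (m<m+n p L>0)
¬Antipodal-refl {L} {p} L>0 (inj₂ p≡p+L) = <-irrefl p≡p+L (m<m+n p L>0)

antipodal-unique : ∀ {L p q r} → p < L + L → r < L + L → Antipodal L p q → Antipodal L q r → p ≡ r
antipodal-unique {L} {p} p<2L r<2L (inj₁ refl) (inj₁ refl) =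
  contradiction r<2L (≤⇒≯ (+-monoˡ-≤ L (m≤n+m L p)))
antipodal-unique {L} {p} {r = r} _ _ (inj₁ refl) (inj₂ p+L≡r+L) = +-cancelʳ-≡ L p r p+L≡r+L
antipodal-unique _ _ (inj₂ refl) (inj₁ refl) = refl
antipodal-unique {L} {r = r} p<2L r<2L (inj₂ refl) (inj₂ refl) =
  contradiction p<2L (≤⇒≯ (+-monoˡ-≤ L (m≤n+m L r)))

-- Orbits of a single edge

module _ {m : ℕ} where

  Incident : OEdge m → Fin m → Set
  Incident (s , t) a = a ≡ s ⊎ a ≡ t

  endpoint : OEdge m → Bool → Fin m
  endpoint (s , t) true  = s
  endpoint (s , t) false = t

  endpoint-incident : ∀ e b → Incident e (endpoint e b)
  endpoint-incident (s , t) true  = inj₁ refl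
  endpoint-incident (s , t) false = inj₂ refl

  incident? : ∀ e a → Dec (Incident e a)
  incident? (s , t) a = (a ≟ s) ⊎-dec (a ≟ t)

  data Position (e : OEdge m) (a : Fin m) : Set where
    on  : ∀ b → a ≡ endpoint e b → Position e a
    off : ¬ Incident e a → Position e a

  position : ∀ e a → Position e a
  position (s , t) a with a ≟ s | a ≟ t
  ... | yes a≡s | _       = on true a≡s
  ... | no _    | yes a≡t = on false a≡t
  ... | no a≢s  | no a≢t  = off [ a≢s , a≢t ]

  position-endpoint : ∀ {e} → proj₁ e ≢ proj₂ e → ∀ b → position e (endpoint e b) ≡ on b refl
  position-endpoint {s , t} s≢t true with position (s , t) s
  ... | on true refl  = refl
  ... | on false s≡t  = contradiction s≡t s≢t
  ... | off ¬incident = contradiction (inj₁ refl) ¬incident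
  position-endpoint {s , t} s≢t false with position (s , t) t
  ... | on false refl = refl
  ... | on true t≡s   = contradiction (sym t≡s) s≢t
  ... | off ¬incident = contradiction (inj₂ refl) ¬incident

  actAt : ∀ {e a n} → Position e a → Word m n → Word m (suc n)
  actAt {e}     (on true _)  w = proj₂ e ∷ act e w
  actAt {e}     (on false _) w = proj₁ e ∷ w
  actAt {a = a} (off _)      w = a ∷ w

  act-∷ : ∀ e a {n} (w : Word m n) → act e (a ∷ w) ≡ actAt (position e a) w
  act-∷ (s , t) a w with a ≟ s
  ... | yes _ = refl
  ... | no _ with a ≟ t
  ...   | yes _ = refl
  ...   | no _  = refl

  -- act e counts in binary on the maximal prefix of endpoints of e, reading proj₁ e as the digit 1
  -- and proj₂ e as 0, least significant digit first; index is the counter, orbitSize = 2ᵏ the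
  -- length of the orbit and half = 2ᵏ⁻¹ (or 0 on a fixed word).
  index : ∀ {n} → OEdge m → Word m n → ℕ
  index e []      = 0
  index e (a ∷ w) with position e a
  ... | on true _  = suc (index e w + index e w)
  ... | on false _ = index e w + index e w
  ... | off _      = 0

  orbitSize : ∀ {n} → OEdge m → Word m n → ℕ
  orbitSize e []      = 1
  orbitSize e (a ∷ w) with position e a
  ... | on _ _ = orbitSize e w + orbitSize e w
  ... | off _  = 1

  half : ∀ {n} → OEdge m → Word m n → ℕ
  half e []      = 0
  half e (a ∷ w) with position e a
  ... | on _ _ = orbitSize e w
  ... | off _  = 0

  data SameOrbit (e : OEdge m) : ∀ {n} → Word m n → Word m n → Set where
    []      : SameOrbit e [] []
    on-edge : ∀ {n a b} {w v : Word m n} → Incident e a → Incident e b → SameOrbit e w v →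
              SameOrbit e (a ∷ w) (b ∷ v)
    off-edge : ∀ {n a} {w : Word m n} → ¬ Incident e a → SameOrbit e (a ∷ w) (a ∷ w)

  SameOrbit-refl : ∀ {e n} (x : Word m n) → SameOrbit e x x
  SameOrbit-refl []              = []
  SameOrbit-refl {e} (a ∷ w) with position e a
  ... | on b refl = on-edge (endpoint-incident e b) (endpoint-incident e b) (SameOrbit-refl w)
  ... | off ¬inc  = off-edge ¬inc

  SameOrbit-sym : ∀ {e n} {x y : Word m n} → SameOrbit e x y → SameOrbit e y x
  SameOrbit-sym []                  = []
  SameOrbit-sym (on-edge ia ib rel) = on-edge ib ia (SameOrbit-sym rel)
  SameOrbit-sym (off-edge ¬ia)      = off-edge ¬ia

  SameOrbit-trans : ∀ {e n} {x y z : Word m n} → SameOrbit e x y → SameOrbit e y z → SameOrbit e x z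
  SameOrbit-trans []                  []                  = []
  SameOrbit-trans (on-edge ia _ xy)   (on-edge _ ic yz)   = on-edge ia ic (SameOrbit-trans xy yz)
  SameOrbit-trans (on-edge _ ib _)    (off-edge ¬ib)      = contradiction ib ¬ib
  SameOrbit-trans (off-edge ¬ia)      (on-edge ia _ _)    = contradiction ia ¬ia
  SameOrbit-trans (off-edge ¬ia)      (off-edge _)        = off-edge ¬ia

  SameOrbit-act : ∀ {e n} (x : Word m n) → SameOrbit e x (act e x)
  SameOrbit-act []               = []
  SameOrbit-act {e} (a ∷ w) rewrite act-∷ e a w with position e a
  ... | on true refl  = on-edge (inj₁ refl) (inj₂ refl) (SameOrbit-act w)
  ... | on false refl = on-edge (inj₂ refl) (inj₁ refl) (SameOrbit-refl w)
  ... | off ¬inc      = off-edge ¬inc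

  orbitSize-cong : ∀ {e n} {x y : Word m n} → SameOrbit e x y → orbitSize e x ≡ orbitSize e y
  orbitSize-cong []                  = refl
  orbitSize-cong (off-edge _)        = refl
  orbitSize-cong {e} (on-edge {a = a} {b} ia ib rel) with position e a | position e b
  ... | on _ _  | on _ _  = cong (λ k → k + k) (orbitSize-cong rel)
  ... | off ¬ia | _       = contradiction ia ¬ia
  ... | on _ _  | off ¬ib = contradiction ib ¬ib

  half-cong : ∀ {e n} {x y : Word m n} → SameOrbit e x y → half e x ≡ half e y
  half-cong []                  = refl
  half-cong (off-edge _)        = refl
  half-cong {e} (on-edge {a = a} {b} ia ib rel) with position e a | position e b
  ... | on _ _  | on _ _  = orbitSize-cong rel
  ... | off ¬ia | _       = contradiction ia ¬ia
  ... | on _ _  | off ¬ib = contradiction ib ¬ib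

  orbitSize>0 : ∀ {e n} (x : Word m n) → 0 < orbitSize e x
  orbitSize>0 []          = s≤s z≤n
  orbitSize>0 {e} (a ∷ w) with position e a
  ... | on _ _ = ≤-trans (orbitSize>0 w) (m≤m+n _ _)
  ... | off _  = s≤s z≤n

  index<orbitSize : ∀ {e n} (x : Word m n) → index e x < orbitSize e x
  index<orbitSize []          = s≤s z≤n
  index<orbitSize {e} (a ∷ w) with position e a
  ... | on true _  = odd<double (index<orbitSize w)
  ... | on false _ = double-mono-< (index<orbitSize w)
  ... | off _      = s≤s z≤n

  half≡0⇒orbitSize≡1 : ∀ {e n} (x : Word m n) → half e x ≡ 0 → orbitSize e x ≡ 1
  half≡0⇒orbitSize≡1 []          _ = refl
  half≡0⇒orbitSize≡1 {e} (a ∷ w) h with position e a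
  ... | on _ _ = contradiction h (>⇒≢ (orbitSize>0 w))
  ... | off _  = refl

  half>0⇒orbitSize≡2half : ∀ {e n} (x : Word m n) → 0 < half e x → orbitSize e x ≡ half e x + half e x
  half>0⇒orbitSize≡2half {e} (a ∷ w) h with position e a
  ... | on _ _ = refl

  ¬incident⇒half≡0 : ∀ {e n} (x : Word m (suc n)) → ¬ Incident e (head x) → half e x ≡ 0
  ¬incident⇒half≡0 {e} (a ∷ w) ¬inc with position e a
  ... | on b refl = contradiction (endpoint-incident e b) ¬inc
  ... | off _     = refl

  half≡0⇒index≡0 : ∀ {e n} (x : Word m n) → half e x ≡ 0 → index e x ≡ 0
  half≡0⇒index≡0 x h = n<1⇒n≡0 (subst (index _ x <_) (half≡0⇒orbitSize≡1 x h) (index<orbitSize x))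

  half≡0⇒act≡ : ∀ {e n} (x : Word m n) → half e x ≡ 0 → act e x ≡ x
  half≡0⇒act≡ []              _ = refl
  half≡0⇒act≡ {e} (a ∷ w) h rewrite act-∷ e a w with position e a
  ... | on _ _ = contradiction h (>⇒≢ (orbitSize>0 w))
  ... | off _  = refl

  index-injective : ∀ {e n} {x y : Word m n} → SameOrbit e x y → index e x ≡ index e y → x ≡ y
  index-injective [] _ = refl
  index-injective (off-edge _) _ = refl
  index-injective {e} (on-edge {a = a} {b} {w} {v} ia ib rel) eq with position e a | position e b
  ... | on true refl  | on true refl  = cong (_ ∷_) (index-injective rel (double-injective _ _ (suc-injective eq)))
  ... | on false refl | on false refl = cong (_ ∷_) (index-injective rel (double-injective _ _ eq))
  ... | on true _     | on false _    = contradiction eq (odd≢double (index e w) (index e v))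
  ... | on false _    | on true _     = contradiction (sym eq) (odd≢double (index e v) (index e w))
  ... | off ¬ia       | _             = contradiction ia ¬ia
  ... | on _ _        | off ¬ib       = contradiction ib ¬ib

  act⁻¹ : ∀ {n} → OEdge m → Word m n → Word m n
  act⁻¹ e []      = []
  act⁻¹ e (a ∷ w) with position e a
  ... | on true _  = proj₂ e ∷ w
  ... | on false _ = proj₁ e ∷ act⁻¹ e w
  ... | off _      = a ∷ w

  antipode : ∀ {n} → OEdge m → Word m n → Word m n
  antipode e []      = []
  antipode e (a ∷ w) with position e a | half e w ≟ℕ 0
  ... | on b _ | yes _ = endpoint e (not b) ∷ w
  ... | on _ _ | no _  = a ∷ antipode e w
  ... | off _  | _     = a ∷ w

  act-moves : ∀ {e n} (x : Word m (suc n)) → act e x ≢ x → Incident e (head x) × Incident e (head (act e x))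
  act-moves {e} (a ∷ w) moves rewrite act-∷ e a w with position e a
  ... | on true refl  = inj₁ refl , inj₂ refl
  ... | on false refl = inj₂ refl , inj₁ refl
  ... | off _         = contradiction refl moves

  module _ {e : OEdge m} (proper : proj₁ e ≢ proj₂ e) where

    index-act : ∀ {n} (x : Word m n) → CyclicSuc (orbitSize e x) (index e x) (index e (act e x))
    index-act []      = inj₂ (refl , refl)
    index-act (a ∷ w) rewrite act-∷ e a w with position e a in eq
    ... | on true refl rewrite position-endpoint proper false = carry (index-act w)
      where
      carry : ∀ {i j S} → CyclicSuc S i j → CyclicSuc (S + S) (suc (i + i)) (j + j)
      carry {i} {S = S} (inj₁ (1+i<S , refl)) =
        inj₁ (subst (_< S + S) (cong suc (+-suc i i)) (double-mono-< 1+i<S) , cong suc (+-suc i i))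
      carry {i} (inj₂ (refl , refl)) = inj₂ (cong suc (sym (+-suc i i)) , refl)
    ... | on false refl rewrite position-endpoint proper true = inj₁ (odd<double (index<orbitSize w) , refl)
    ... | off _ rewrite eq = inj₂ (refl , refl)

    act-act⁻¹ : ∀ {n} (x : Word m n) → act e (act⁻¹ e x) ≡ x
    act-act⁻¹ []      = refl
    act-act⁻¹ (a ∷ w) with position e a in eq
    ... | on true refl  rewrite act-∷ e (proj₂ e) w | position-endpoint proper false = refl
    ... | on false refl rewrite act-∷ e (proj₁ e) (act⁻¹ e w) | position-endpoint proper true =
      cong (proj₂ e ∷_) (act-act⁻¹ w)
    ... | off _ rewrite act-∷ e a w | eq = refl

    SameOrbit-antipode : ∀ {n} (x : Word m n) → 0 < half e x → SameOrbit e x (antipode e x)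
    SameOrbit-antipode (a ∷ w) h with position e a | half e w ≟ℕ 0
    ... | on b refl | yes _  = on-edge (endpoint-incident e b) (endpoint-incident e (not b)) (SameOrbit-refl w)
    ... | on b refl | no hw = on-edge (endpoint-incident e b) (endpoint-incident e b)
                                      (SameOrbit-antipode w (n≢0⇒n>0 hw))

    index-antipode : ∀ {n} (x : Word m n) → 0 < half e x →
                     Antipodal (half e x) (index e x) (index e (antipode e x))
    index-antipode (a ∷ w) h with position e a | half e w ≟ℕ 0
    ... | on true refl | yes hw
      rewrite position-endpoint proper false | half≡0⇒index≡0 w hw | half≡0⇒orbitSize≡1 w hw = inj₂ refl
    ... | on false refl | yes hw
      rewrite position-endpoint proper true | half≡0⇒index≡0 w hw | half≡0⇒orbitSize≡1 w hw = inj₁ refl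
    ... | on true refl | no hw
      rewrite position-endpoint proper true | half>0⇒orbitSize≡2half w (n≢0⇒n>0 hw) =
      Antipodal-odd (index-antipode w (n≢0⇒n>0 hw))
    ... | on false refl | no hw
      rewrite position-endpoint proper false | half>0⇒orbitSize≡2half w (n≢0⇒n>0 hw) =
      Antipodal-double (index-antipode w (n≢0⇒n>0 hw))

    antipode≢ : ∀ {n} (x : Word m n) → 0 < half e x → antipode e x ≢ x
    antipode≢ x h eq =
      ¬Antipodal-refl h (subst (λ y → Antipodal (half e x) (index e x) (index e y)) eq (index-antipode x h))

-- Sides of the edges of a tree

-- For a tree, side e a is true exactly when a lies in the component of proj₁ e in G − e.
record SideFunction {m : ℕ} (E : List (OEdge m)) : Set where
  field
    side            : OEdge m → Fin m → Bool
    side-endpoint   : ∀ {e} → e ∈ E → ∀ b → side e (endpoint e b) ≡ b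
    side-other-edge : ∀ {e f} → e ∈ E → f ∈ E → f ≢ e → side e (proj₁ f) ≡ side e (proj₂ f)
    separating-edge : ∀ {a b} → a ≢ b → ∃ λ e → e ∈ E × Incident e a × side e a ≢ side e b

module Labelling {m : ℕ} where

  merge : (Fin m → Fin m) → OEdge m → Fin m → Fin m
  merge l (a , b) x = if does (l x ≟ l b) then l a else l x

  -- label es x is a representative of the component of x in the graph with edge list es.
  label : List (OEdge m) → Fin m → Fin m
  label []       x = x
  label (f ∷ es) x = merge (label es) f x

  label-edge : ∀ {es a b} → (a , b) ∈ es → label es a ≡ label es b
  label-edge {(a , b) ∷ es} (here refl) with label es a ≟ label es b | label es b ≟ label es b
  ... | yes _ | yes _   = refl
  ... | no _  | yes _   = refl
  ... | _     | no b≢b  = contradiction refl b≢b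
  label-edge {(a′ , b′) ∷ es} {a} {b} (there ab∈) =
    cong (λ k → if does (k ≟ label es b′) then label es a′ else k) (label-edge ab∈)

  roots : List (OEdge m) → ℕ
  roots es = ∑[ x ∈ allFin m ] 𝟙 (label es x ≟ x)

  roots-∷ : ∀ f es → roots es ≤ roots (f ∷ es) + 1
  roots-∷ f@(a , b) es = begin
    roots es
      ≤⟨ ∑-mono-≤ (allFin m) (λ {x} _ → pointwise x) ⟩
    ∑[ x ∈ allFin m ] (𝟙 (label (f ∷ es) x ≟ x) + 𝟙 (x ≟ label es b))
      ≡⟨ ∑-+ (allFin m) _ _ ⟩
    roots (f ∷ es) + ∑[ x ∈ allFin m ] 𝟙 (x ≟ label es b)
      ≡⟨ cong (roots (f ∷ es) +_) (∑-𝟙-allFin (label es b)) ⟩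
    roots (f ∷ es) + 1 ∎
    where
    open ≤-Reasoning
    pointwise : ∀ x → 𝟙 (label es x ≟ x) ≤ 𝟙 (label (f ∷ es) x ≟ x) + 𝟙 (x ≟ label es b)
    pointwise x with label es x ≟ x
    ... | no _ = z≤n
    ... | yes root with x ≟ label es b
    ...   | yes _ = m≤n+m 1 _
    ...   | no x≢b = ≤-trans (≤-reflexive (sym (𝟙-yes (label (f ∷ es) x ≟ x) stays))) (m≤m+n _ 0)
      where
      stays : label (f ∷ es) x ≡ x
      stays with label es x ≟ label es b
      ... | yes x~b = contradiction (trans (sym root) x~b) x≢b
      ... | no _    = root

  m≤roots+length : ∀ es → m ≤ roots es + length es
  m≤roots+length [] = ≤-reflexive (begin
    m                                ≡⟨ length-tabulate {n = m} id ⟨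
    length (allFin m)                ≡⟨ length-as-∑ (allFin m) ⟩
    ∑[ x ∈ allFin m ] 1              ≡⟨ ∑-cong (allFin m) (λ {x} _ → 𝟙-yes (x ≟ x) refl) ⟨
    roots []                         ≡⟨ +-identityʳ (roots []) ⟨
    roots [] + 0                     ∎)
    where open ≡-Reasoning
  m≤roots+length (f ∷ es) = begin
    m                                ≤⟨ m≤roots+length es ⟩
    roots es + length es             ≤⟨ +-monoˡ-≤ (length es) (roots-∷ f es) ⟩
    roots (f ∷ es) + 1 + length es   ≡⟨ +-assoc (roots (f ∷ es)) 1 (length es) ⟩
    roots (f ∷ es) + length (f ∷ es) ∎
    where open ≤-Reasoning

  roots≤1 : ∀ es {r} → (∀ x → label es x ≡ r) → roots es ≤ 1
  roots≤1 es {r} constant = ≤-trans (∑-mono-≤ (allFin m) (λ {x} _ → pointwise x)) (≤-reflexive (∑-𝟙-allFin r))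
    where
    pointwise : ∀ x → 𝟙 (label es x ≟ x) ≤ 𝟙 (x ≟ r)
    pointwise x with label es x ≟ x
    ... | no _    = z≤n
    ... | yes root = ≤-reflexive (sym (𝟙-yes (x ≟ r) (trans (sym root) (constant x))))

  constant-label⇒m≤1+length : ∀ es {r} → (∀ x → label es x ≡ r) → m ≤ suc (length es)
  constant-label⇒m≤1+length es constant = ≤-trans (m≤roots+length es) (+-monoˡ-≤ (length es) (roots≤1 es constant))

module TreeSides {m : ℕ} {E : List (OEdge m)} (tree : IsTree m E) where
  open IsTree tree
  open Labelling

  Ends : OEdge m → Fin m → Fin m → Set
  Ends f x y = (proj₁ f ≡ x × proj₂ f ≡ y) ⊎ (proj₁ f ≡ y × proj₂ f ≡ x)

  others : OEdge m → List (OEdge m)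
  others e = filter (λ f → ¬? (f ≟ᵉ e)) E

  side : OEdge m → Fin m → Bool
  side e x = does (label (others e) x ≟ label (others e) (proj₁ e))

  label-others : ∀ {e f} → f ∈ E → f ≢ e → label (others e) (proj₁ f) ≡ label (others e) (proj₂ f)
  label-others {e} f∈E f≢e = label-edge (∈-filter⁺ (λ f → ¬? (f ≟ᵉ e)) f∈E f≢e)

  -- Otherwise G − e would be connected with only m − 2 edges.
  side-target : ∀ {e} → e ∈ E → side e (proj₂ e) ≡ false
  side-target {e@(s , t)} e∈E = dec-false (label es t ≟ label es s) λ t~s →
    <-irrefl refl (begin-strict
      length E                  <⟨ ≤-reflexive edge-count′ ⟩
      m                         ≤⟨ constant-label⇒m≤1+length es (λ x → walk (connected x s) t~s) ⟩
      suc (length es)           ≤⟨ filter-notAll (λ f → ¬? (f ≟ᵉ e)) E (Any.map (λ { refl f≢e → f≢e refl }) e∈E) ⟩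
      length E                  ∎)
    where
    open ≤-Reasoning
    es = others e
    edge-count′ : suc (length E) ≡ m
    edge-count′ = trans (+-comm 1 (length E)) edgeCount
    walk : ∀ {x y} → Star (AdjG E) x y → label es t ≡ label es s → label es x ≡ label es y
    walk ε               _   = refl
    walk (x~y ◅ y⇝z) t~s with find x~y
    ... | f , f∈E , ends with f ≟ᵉ e | ends
    ...   | yes refl | inj₁ (refl , refl) = trans (sym t~s) (walk y⇝z t~s)
    ...   | yes refl | inj₂ (refl , refl) = trans t~s (walk y⇝z t~s)
    ...   | no f≢e   | inj₁ (refl , refl) = trans (label-others f∈E f≢e) (walk y⇝z t~s)
    ...   | no f≢e   | inj₂ (refl , refl) = trans (sym (label-others f∈E f≢e)) (walk y⇝z t~s)

  side-endpoint : ∀ {e} → e ∈ E → ∀ b → side e (endpoint e b) ≡ b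
  side-endpoint {e} e∈E true  = dec-true (label (others e) (proj₁ e) ≟ _) refl
  side-endpoint {e} e∈E false = side-target e∈E

  side-other-edge : ∀ {e f} → e ∈ E → f ∈ E → f ≢ e → side e (proj₁ f) ≡ side e (proj₂ f)
  side-other-edge {e} _ f∈E f≢e = cong (λ k → does (k ≟ label (others e) (proj₁ e))) (label-others f∈E f≢e)

  private
    ends-incident : ∀ {f x y} → Ends f x y → Incident f x
    ends-incident (inj₁ (refl , _)) = inj₁ refl
    ends-incident (inj₂ (_ , refl)) = inj₂ refl

    ends-sides≢ : ∀ {f x y} → f ∈ E → Ends f x y → side f x ≢ side f y
    ends-sides≢ f∈E (inj₁ (refl , refl)) eq
      with trans (sym (side-endpoint f∈E true)) (trans eq (side-endpoint f∈E false))
    ... | ()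
    ends-sides≢ f∈E (inj₂ (refl , refl)) eq
      with trans (sym (side-endpoint f∈E false)) (trans eq (side-endpoint f∈E true))
    ... | ()

    ends-same-side : ∀ {e f x y} → e ∈ E → f ∈ E → f ≢ e → Ends f x y → side e x ≡ side e y
    ends-same-side e∈E f∈E f≢e (inj₁ (refl , refl)) = side-other-edge e∈E f∈E f≢e
    ends-same-side e∈E f∈E f≢e (inj₂ (refl , refl)) = sym (side-other-edge e∈E f∈E f≢e)

    ends-avoid : ∀ {f x y a} → Ends f x y → x ≢ a → y ≢ a → ¬ Incident f a
    ends-avoid (inj₁ (refl , refl)) x≢a y≢a (inj₁ refl) = x≢a refl
    ends-avoid (inj₁ (refl , refl)) x≢a y≢a (inj₂ refl) = y≢a refl
    ends-avoid (inj₂ (refl , refl)) x≢a y≢a (inj₁ refl) = y≢a refl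
    ends-avoid (inj₂ (refl , refl)) x≢a y≢a (inj₂ refl) = x≢a refl

  -- The last step of a walk from a to b that leaves a crosses such an edge.
  separating-edge : ∀ {a b} → a ≢ b → ∃ λ e → e ∈ E × Incident e a × side e a ≢ side e b
  separating-edge {a} {b} a≢b with walk (connected a b)
    where
    Separated = ∃ λ e → e ∈ E × Incident e a × side e a ≢ side e b
    walk : ∀ {x} → Star (AdjG E) x b →
           Separated ⊎ (x ≢ a × ∀ {e} → e ∈ E → Incident e a → side e x ≡ side e b)
    walk ε = inj₂ (a≢b ∘ sym , λ _ _ → refl)
    walk {x} (x~y ◅ y⇝b) with walk y⇝b
    ... | inj₁ separated = inj₁ separated
    ... | inj₂ (y≢a , y-like-b) with find x~y
    ...   | f , f∈E , ends with x ≟ a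
    ...     | yes refl = inj₁ (f , f∈E , ends-incident ends ,
                               λ eq → ends-sides≢ f∈E ends (trans eq (sym (y-like-b f∈E (ends-incident ends)))))
    ...     | no x≢a =
      inj₂ (x≢a , λ e∈E a∈e → trans (ends-same-side e∈E f∈E (f≢e a∈e) ends) (y-like-b e∈E a∈e))
      where
      f≢e : ∀ {e} → Incident e a → f ≢ e
      f≢e a∈e refl = ends-avoid ends x≢a y≢a a∈e
  ... | inj₁ separated     = separated
  ... | inj₂ (a≢a , _)     = contradiction refl a≢a

  sideFunction : SideFunction E
  sideFunction = record
    { side            = side
    ; side-endpoint   = side-endpoint
    ; side-other-edge = side-other-edge
    ; separating-edge = separating-edge
    }

  E-unique : Unique E
  E-unique = AllPairs.map (λ { {s , t} distinct refl → distinct (inj₁ (refl , refl)) }) noMulti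

-- Gates and cuts

module Gates {m : ℕ} {E : List (OEdge m)} (S : SideFunction E) where
  open SideFunction S

  proper : ∀ {e} → e ∈ E → proj₁ e ≢ proj₂ e
  proper {e} e∈E s≡t with trans (sym (side-endpoint e∈E true)) (trans (cong (side e) s≡t) (side-endpoint e∈E false))
  ... | ()

  endpoint-side : ∀ {e a} → e ∈ E → Incident e a → endpoint e (side e a) ≡ a
  endpoint-side {e} e∈E (inj₁ refl) = cong (endpoint e) (side-endpoint e∈E true)
  endpoint-side {e} e∈E (inj₂ refl) = cong (endpoint e) (side-endpoint e∈E false)

  module _ {e f} (e∈E : e ∈ E) (f∈E : f ∈ E) (f≢e : f ≢ e) where

    side-incident₁ : ∀ {c} → Incident f c → side e c ≡ side e (proj₁ f)
    side-incident₁ (inj₁ refl) = refl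
    side-incident₁ (inj₂ refl) = sym (side-other-edge e∈E f∈E f≢e)

    side-incident₂ : ∀ {c} → Incident f c → side e c ≡ side e (proj₂ f)
    side-incident₂ (inj₁ refl) = side-other-edge e∈E f∈E f≢e
    side-incident₂ (inj₂ refl) = refl

  -- gate e w y is the word of the e-orbit of w nearest to y.  If the head of w lies on e, the tail
  -- of the gate is the gate o of the tail of y, and its head is the endpoint of e on the side from
  -- which y reaches the words · ∷ o, namely entry e o (head y) (tail y).  The value of innerEntry
  -- on [] is never used.
  mutual
    entry : ∀ {n} → OEdge m → Word m n → Fin m → Word m n → Bool
    entry e o b y with y ≟ʷ o
    ... | yes _ = side e b
    ... | no _  = innerEntry e o y

    innerEntry : ∀ {n} → OEdge m → Word m n → Word m n → Bool
    innerEntry e []      y = true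
    innerEntry e (a ∷ w) y with position e a
    ... | on _ _ = entry e w (head y) (tail y)
    ... | off _  = side e a

  gate : ∀ {n} → OEdge m → Word m n → Word m n → Word m n
  gate e []      y = []
  gate e (a ∷ w) y with position e a
  ... | on _ _ = endpoint e (entry e (gate e w (tail y)) (head y) (tail y)) ∷ gate e w (tail y)
  ... | off _  = a ∷ w

  entry-≡ : ∀ {e n} {o y : Word m n} b → y ≡ o → entry e o b y ≡ side e b
  entry-≡ {o = o} {y} b y≡o with y ≟ʷ o
  ... | yes _   = refl
  ... | no y≢o  = contradiction y≡o y≢o

  entry-≢ : ∀ {e n} {o y : Word m n} b → y ≢ o → entry e o b y ≡ innerEntry e o y
  entry-≢ {o = o} {y} b y≢o with y ≟ʷ o
  ... | yes y≡o = contradiction y≡o y≢o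
  ... | no _    = refl

  gate-SameOrbit : ∀ {e n} (w y : Word m n) → SameOrbit e w (gate e w y)
  gate-SameOrbit []          y = []
  gate-SameOrbit {e} (a ∷ w) y with position e a
  ... | on b refl  =
    on-edge (endpoint-incident e b) (endpoint-incident e (entry e (gate e w (tail y)) (head y) (tail y)))
            (gate-SameOrbit w (tail y))
  ... | off ¬inc   = off-edge ¬inc

  gate-fixed : ∀ {e n} {w y : Word m n} → e ∈ E → SameOrbit e w y → gate e w y ≡ y
  gate-fixed e∈E [] = refl
  gate-fixed {e} e∈E (on-edge {a = a} {b} {w} {y} ia ib rel) with position e a
  ... | on _ _  = cong₂ _∷_ (trans (cong (endpoint e) (entry-≡ b (sym IH))) (endpoint-side e∈E ib)) IH
    where IH = gate-fixed e∈E rel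
  ... | off ¬ia = contradiction ia ¬ia
  gate-fixed {e} e∈E (off-edge {a = a} ¬ia) with position e a
  ... | on b refl = contradiction (endpoint-incident e b) ¬ia
  ... | off _     = refl

  half≡0⇒gate≡ : ∀ {e n} (x y : Word m n) → half e x ≡ 0 → gate e x y ≡ x
  half≡0⇒gate≡ []          y _ = refl
  half≡0⇒gate≡ {e} (a ∷ w) y h with position e a
  ... | on _ _ = contradiction h (>⇒≢ (orbitSize>0 w))
  ... | off _  = refl

  gate-cong : ∀ {e n} {w w′ : Word m n} (z : Word m n) → SameOrbit e w w′ → gate e w z ≡ gate e w′ z
  gate-cong z [] = refl
  gate-cong z (off-edge _) = refl
  gate-cong {e} z (on-edge {a = a} {a′} ia ia′ rel) with position e a | position e a′
  ... | on _ _  | on _ _   = cong (λ o → endpoint e (entry e o (head z) (tail z)) ∷ o) (gate-cong (tail z) rel)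
  ... | off ¬ia | _        = contradiction ia ¬ia
  ... | on _ _  | off ¬ia′ = contradiction ia′ ¬ia′

  innerEntry-gate : ∀ {e n} → e ∈ E → (w y : Word m (suc n)) →
                    innerEntry e (gate e w y) y ≡ side e (head (gate e w y))
  innerEntry-gate {e} e∈E (a ∷ w) y with position e a in eq
  ... | on _ refl rewrite position-endpoint (proper e∈E) (entry e (gate e w (tail y)) (head y) (tail y)) =
    sym (side-endpoint e∈E _)
  ... | off _ rewrite eq = refl

  private
    module EntryAct {e f n} (e∈E : e ∈ E) (f∈E : f ∈ E) (w y : Word m (suc n))
                    (gate-eq : gate e w (act f y) ≡ gate e w y)
                    (¬same : ¬ (f ≡ e × SameOrbit e (gate e w y) y)) where
      o = gate e w y

      f≢e-at : y ≡ o → f ≢ e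
      f≢e-at y≡o f≡e = ¬same (f≡e , subst (SameOrbit e o) (sym y≡o) (SameOrbit-refl o))

      innerEntry-gate′ : ∀ y′ → gate e w y′ ≡ o → innerEntry e o y′ ≡ side e (head o)
      innerEntry-gate′ y′ eq = subst (λ o → innerEntry e o y′ ≡ side e (head o)) eq (innerEntry-gate e∈E w y′)

      entry-act′ : entry e o (proj₁ f) y ≡ entry e o (proj₂ f) (act f y)
      entry-act′ with y ≟ʷ o | act f y ≟ʷ o
      ... | yes y≡o | yes _ = side-other-edge e∈E f∈E (f≢e-at y≡o)
      ... | yes y≡o | no fy≢o =
        sym (trans (innerEntry-gate′ (act f y) gate-eq)
                   (side-incident₁ e∈E f∈E (f≢e-at y≡o)
                     (subst (Incident f ∘ head) y≡o (proj₁ (act-moves y (λ fy≡y → fy≢o (trans fy≡y y≡o)))))))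
      ... | no y≢o | yes fy≡o =
        trans (innerEntry-gate′ y refl)
              (side-incident₂ e∈E f∈E f≢e
                (subst (Incident f ∘ head) fy≡o (proj₂ (act-moves y (λ fy≡y → y≢o (trans (sym fy≡y) fy≡o))))))
        where
        f≢e : f ≢ e
        f≢e refl = ¬same (refl , subst (λ o → SameOrbit e o y) fy≡o (SameOrbit-sym (SameOrbit-act y)))
      ... | no _ | no _ = trans (innerEntry-gate′ y refl) (sym (innerEntry-gate′ (act f y) gate-eq))

  entry-act : ∀ {e f n} → e ∈ E → f ∈ E → (w y : Word m n) →
              gate e w (act f y) ≡ gate e w y → ¬ (f ≡ e × SameOrbit e (gate e w y) y) →
              entry e (gate e w y) (proj₁ f) y ≡ entry e (gate e w y) (proj₂ f) (act f y)
  entry-act e∈E f∈E []          [] _ ¬same = side-other-edge e∈E f∈E (λ f≡e → ¬same (f≡e , []))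
  entry-act e∈E f∈E w@(_ ∷ _) y          = EntryAct.entry-act′ e∈E f∈E w y

  gate-act : ∀ {e f n} → e ∈ E → f ∈ E → (w x : Word m n) → ¬ (f ≡ e × SameOrbit e w x) →
             gate e w x ≡ gate e w (act f x)
  gate-act e∈E f∈E [] [] _ = refl
  gate-act {e} {f} e∈E f∈E (a ∷ w) (b ∷ y) ¬same with position e a
  ... | off _ = refl
  ... | on c refl rewrite act-∷ f b y with position f b
  ...   | on true refl = cong₂ _∷_ (cong (endpoint e) entry-eq) IH
    where
    ¬same′ : ¬ (f ≡ e × SameOrbit e w y)
    ¬same′ (refl , rel) = ¬same (refl , on-edge (endpoint-incident e c) (inj₁ refl) rel)
    IH : gate e w y ≡ gate e w (act f y)
    IH = gate-act e∈E f∈E w y ¬same′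
    entry-eq : entry e (gate e w y) (proj₁ f) y ≡ entry e (gate e w (act f y)) (proj₂ f) (act f y)
    entry-eq = trans (entry-act e∈E f∈E w y (sym IH)
                       (λ { (refl , rel) → ¬same′ (refl , SameOrbit-trans (gate-SameOrbit w y) rel) }))
                     (cong (λ o → entry e o (proj₂ f) (act f y)) IH)
  ...   | on false refl = cong (λ c → endpoint e c ∷ gate e w y) entry-eq
    where
    entry-eq : entry e (gate e w y) (proj₂ f) y ≡ entry e (gate e w y) (proj₁ f) y
    entry-eq with y ≟ʷ gate e w y
    ... | yes y≡o = sym (side-other-edge e∈E f∈E f≢e)
      where
      f≢e : f ≢ e
      f≢e refl = ¬same (refl , on-edge (endpoint-incident e c) (inj₂ refl)
                                       (subst (SameOrbit e w) (sym y≡o) (gate-SameOrbit w y)))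
    ... | no _ = refl
  ...   | off _ = refl

  gate≡self : ∀ {e a n} {w : Word m n} (y : Word m (suc n)) → e ∈ E → Incident e a →
              gate e (a ∷ w) y ≡ a ∷ w → gate e w (tail y) ≡ w × entry e w (head y) (tail y) ≡ side e a
  gate≡self {e} {a} {w = w} y e∈E ia eq with position e a
  ... | off ¬ia   = contradiction ia ¬ia
  ... | on c refl = tail-fixed , (begin
    entry e w (head y) (tail y)                        ≡⟨ cong (λ o → entry e o (head y) (tail y)) tail-fixed ⟨
    entry e (gate e w (tail y)) (head y) (tail y)      ≡⟨ side-endpoint e∈E _ ⟨
    side e (endpoint e (entry e (gate e w (tail y)) (head y) (tail y))) ≡⟨ cong (side e) (proj₁ (∷-injective eq)) ⟩
    side e (endpoint e c)                              ∎)
    where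
    open ≡-Reasoning
    tail-fixed : gate e w (tail y) ≡ w
    tail-fixed = proj₂ (∷-injective eq)

  -- If the tails of
  -- x and y agree, the tree edge at head x separating it from head y will do; otherwise either the
  -- edge found for the tails (by induction, at the head of the tail of x) will do, or the tree edge
  -- at head x separating it from that head.
  private
    moving-edge-∷ : ∀ {n} a b {w z : Word m n} c →
                    (∀ {e} → e ∈ E → gate e w z ≡ w → entry e w b z ≡ side e c) →
                    (a ≡ c → ∃ λ e → e ∈ E × Incident e a × gate e w z ≢ w) →
                    ∃ λ e → e ∈ E × Incident e a × gate e (a ∷ w) (b ∷ z) ≢ a ∷ w
    moving-edge-∷ a b c reports at-c with a ≟ c
    ... | yes a≡c =
      let e , e∈E , ia , moves = at-c a≡c
      in  e , e∈E , ia , moves ∘ proj₁ ∘ gate≡self (b ∷ _) e∈E ia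
    ... | no a≢c =
      let e , e∈E , ia , sides≢ = separating-edge a≢c
      in  e , e∈E , ia , λ fixed → let tail-fixed , entry≡ = gate≡self (b ∷ _) e∈E ia fixed
                                   in  sides≢ (trans (sym entry≡) (reports e∈E tail-fixed))

  moving-edge : ∀ {n} (x y : Word m (suc n)) → x ≢ y → ∃ λ e → e ∈ E × Incident e (head x) × gate e x y ≢ x
  moving-edge (a ∷ w) (b ∷ z) x≢y with w ≟ʷ z
  ... | yes refl = moving-edge-∷ a b b (λ _ _ → entry-≡ {o = w} b refl) (λ { refl → contradiction refl x≢y })
  moving-edge (a ∷ [])    (b ∷ [])    x≢y | no w≢z = contradiction refl w≢z
  moving-edge (a ∷ w@(_ ∷ _)) (b ∷ z) x≢y | no w≢z = moving-edge-∷ a b (head w) reports at-head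
    where
    reports : ∀ {e} → e ∈ E → gate e w z ≡ w → entry e w b z ≡ side e (head w)
    reports {e} e∈E fixed = begin
      entry e w b z                         ≡⟨ entry-≢ b (w≢z ∘ sym) ⟩
      innerEntry e w z                      ≡⟨ cong (λ o → innerEntry e o z) fixed ⟨
      innerEntry e (gate e w z) z           ≡⟨ innerEntry-gate e∈E w z ⟩
      side e (head (gate e w z))            ≡⟨ cong (side e ∘ head) fixed ⟩
      side e (head w)                       ∎
      where open ≡-Reasoning
    at-head : a ≡ head w → ∃ λ e → e ∈ E × Incident e a × gate e w z ≢ w
    at-head refl = moving-edge w z w≢z

module Cuts {m : ℕ} {E : List (OEdge m)} (S : SideFunction E) where
  open SideFunction S
  open Gates S

  -- cut e u z: the gate of z lies on the half of the e-cycle through u that starts at act e u.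
  cut : ∀ {n} → OEdge m → Word m n → Word m n → Bool
  cut e u z = ahead (half e u) (index e u) (index e (gate e u z))

  module _ {e} (e∈E : e ∈ E) where

    index<2half : ∀ {n} {x y : Word m n} → SameOrbit e x y → 0 < half e x → index e y < half e x + half e x
    index<2half {x = x} {y} rel h =
      subst (index e y <_) (trans (sym (orbitSize-cong rel)) (half>0⇒orbitSize≡2half x h)) (index<orbitSize y)

    cut-on-orbit : ∀ {n} {u y : Word m n} → SameOrbit e u y → cut e u y ≡ ahead (half e u) (index e u) (index e y)
    cut-on-orbit {u = u} rel = cong (ahead (half e u) (index e u) ∘ index e) (gate-fixed e∈E rel)

    cut-self : ∀ {n} (x : Word m n) → 0 < half e x → cut e x x ≡ false
    cut-self x h = trans (cut-on-orbit (SameOrbit-refl x)) (dec-false (ahead? _ _ _) (¬Ahead-refl h (index e x)))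

    index-act-2half : ∀ {n} (x : Word m n) → 0 < half e x →
                      CyclicSuc (half e x + half e x) (index e x) (index e (act e x))
    index-act-2half x h = subst (λ N → CyclicSuc N (index e x) (index e (act e x)))
                                (half>0⇒orbitSize≡2half x h) (index-act (proper e∈E) x)

    cut-act : ∀ {n} (x : Word m n) → 0 < half e x → cut e x (act e x) ≡ true
    cut-act x h = trans (cut-on-orbit (SameOrbit-act x)) (dec-true (ahead? _ _ _) (Ahead-suc h (index-act-2half x h)))

    cut-antipode : ∀ {n} (x : Word m n) → 0 < half e x → ∀ z → cut e (antipode e x) z ≡ not (cut e x z)
    cut-antipode x h z = begin
      cut e x̄ z
        ≡⟨ cong₂ (λ L o → ahead L (index e x̄) (index e o)) (half-cong (SameOrbit-sym rel)) (gate-cong z (SameOrbit-sym rel)) ⟩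
      ahead (half e x) (index e x̄) (index e (gate e x z))
        ≡⟨ ahead-antipode (index<2half (SameOrbit-refl x) h) (index<2half rel h)
                          (index<2half (gate-SameOrbit x z) h) (index-antipode (proper e∈E) x h) ⟩
      not (cut e x z) ∎
      where
      open ≡-Reasoning
      x̄ = antipode e x
      rel = SameOrbit-antipode (proper e∈E) x h

    cut-act-off-orbit : ∀ {f n} (u x : Word m n) → f ∈ E → ¬ (f ≡ e × SameOrbit e u x) →
                        cut e u x ≡ cut e u (act f x)
    cut-act-off-orbit u x f∈E ¬same = cong (ahead (half e u) (index e u) ∘ index e) (gate-act e∈E f∈E u x ¬same)

    cut-act-on-orbit : ∀ {n} {u x : Word m n} → SameOrbit e u x → 0 < half e x →
                       cut e u x ≢ cut e u (act e x) → u ≡ x ⊎ u ≡ antipode e x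
    cut-act-on-orbit {u = u} {x} rel h cuts≢ with index e x ≟ℕ index e u
    ... | yes q≡p = inj₁ (index-injective rel (sym q≡p))
    ... | no q≢p with (index e x ≟ℕ index e u + half e x) ⊎-dec (index e u ≟ℕ index e x + half e x)
    ...   | yes antipodal =
      inj₂ (index-injective (SameOrbit-trans rel (SameOrbit-antipode (proper e∈E) x h))
                            (antipodal-unique p<2L (index<2half (SameOrbit-antipode (proper e∈E) x h) h)
                                              antipodal (index-antipode (proper e∈E) x h)))
      where p<2L = index<2half (SameOrbit-sym rel) h
    ...   | no ¬antipodal = contradiction (begin
      cut e u x
        ≡⟨ cut-on-orbit rel ⟩
      ahead (half e u) (index e u) (index e x)
        ≡⟨ cong (λ L → ahead L (index e u) (index e x)) (half-cong rel) ⟩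
      ahead (half e x) (index e u) (index e x)
        ≡⟨ ahead-cong-suc (index<2half (SameOrbit-sym rel) h) (index-act-2half x h) q≢p ¬antipodal ⟩
      ahead (half e x) (index e u) (index e (act e x))
        ≡⟨ cong (λ L → ahead L (index e u) (index e (act e x))) (half-cong rel) ⟨
      ahead (half e u) (index e u) (index e (act e x))
        ≡⟨ cut-on-orbit (SameOrbit-trans rel (SameOrbit-act x)) ⟨
      cut e u (act e x) ∎) cuts≢
      where open ≡-Reasoning

module Crossings {m : ℕ} {E : List (OEdge m)} (S : SideFunction E) (E-unique : Unique E) where
  open SideFunction S
  open Gates S
  open Cuts S

  crossings : ∀ {n} → Word m n → Word m n → ℕ
  crossings {n} x y = ∑[ u ∈ allWords m n ] ∑[ e ∈ E ] differ (cut e u x) (cut e u y)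

  crossings-refl : ∀ {n} (x : Word m n) → crossings x x ≡ 0
  crossings-refl {n} x = trans (∑-cong (allWords m n) (λ _ → trans (∑-cong E (λ _ → differ-refl _)) (∑-zero E)))
                               (∑-zero (allWords m n))

  crossings-sym : ∀ {n} (x y : Word m n) → crossings x y ≡ crossings y x
  crossings-sym {n} x y = ∑-cong (allWords m n) (λ _ → ∑-cong E (λ _ → differ-sym _ _))

  module _ {e n} (e∈E : e ∈ E) (x : Word m n) (moves : 0 < half e x) where

    private
      x′ = act e x
      x̄  = antipode e x

    cut-act-stable : ∀ u → u ≢ x → u ≢ x̄ → cut e u x ≡ cut e u x′
    cut-act-stable u u≢x u≢x̄ with cut e u x B.≟ cut e u x′
    ... | yes cuts≡ = cuts≡
    ... | no cuts≢ with gate e u x ≟ʷ x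
    ...   | yes gate≡x = contradiction (cut-act-on-orbit e∈E rel moves cuts≢) [ u≢x , u≢x̄ ]
      where rel = subst (SameOrbit e u) gate≡x (gate-SameOrbit u x)
    ...   | no gate≢x = contradiction (cut-act-off-orbit e∈E u x e∈E (gate≢x ∘ gate-fixed e∈E ∘ proj₂)) cuts≢

    -- Moving x to act e x switches only the cuts of the e-edges at x and at its antipode; weight
    -- marks these two Γ-edges.
    private
      weight : Word m n → OEdge m → ℕ
      weight u f = 𝟙 (f ≟ᵉ e) * (𝟙 (u ≟ʷ x) + 𝟙 (u ≟ʷ x̄))

      total-weight : ∑[ u ∈ allWords m n ] ∑[ f ∈ E ] weight u f ≡ 2
      total-weight = begin
        ∑[ u ∈ allWords m n ] ∑[ f ∈ E ] weight u f
          ≡⟨ ∑-cong (allWords m n) (λ {u} _ → ∑-*ʳ E (λ f → 𝟙 (f ≟ᵉ e)) _) ⟩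
        ∑[ u ∈ allWords m n ] ((∑[ f ∈ E ] 𝟙 (f ≟ᵉ e)) * (𝟙 (u ≟ʷ x) + 𝟙 (u ≟ʷ x̄)))
          ≡⟨ ∑-cong (allWords m n) (λ {u} _ → trans (cong (_* (𝟙 (u ≟ʷ x) + 𝟙 (u ≟ʷ x̄)))
                                                          (∑-𝟙-unique _≟ᵉ_ E-unique e∈E))
                                                    (*-identityˡ _)) ⟩
        ∑[ u ∈ allWords m n ] (𝟙 (u ≟ʷ x) + 𝟙 (u ≟ʷ x̄))
          ≡⟨ ∑-+ (allWords m n) _ _ ⟩
        ∑[ u ∈ allWords m n ] 𝟙 (u ≟ʷ x) + ∑[ u ∈ allWords m n ] 𝟙 (u ≟ʷ x̄)
          ≡⟨ cong₂ _+_ (∑-𝟙-allWords x) (∑-𝟙-allWords x̄) ⟩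
        2 ∎
        where open ≡-Reasoning

      balance-at : ∀ w u {f} → f ∈ E →
                   differ (cut f u w) (cut f u x) + weight u f * differ (cut e x w) true ≡
                   differ (cut f u w) (cut f u x′) + weight u f * differ (cut e x w) false
      balance-at w u {f} f∈E with f ≟ᵉ e
      ... | no f≢e = cong (λ b → differ (cut f u w) b + 0) (cut-act-off-orbit f∈E u x e∈E (f≢e ∘ sym ∘ proj₁))
      ... | yes refl with u ≟ʷ x | u ≟ʷ x̄
      ...   | yes refl | yes x≡x̄ = contradiction (sym x≡x̄) (antipode≢ (proper e∈E) x moves)
      ...   | yes refl | no _ rewrite cut-self e∈E x moves | cut-act e∈E x moves with cut e x w
      ...     | true  = refl
      ...     | false = refl
      balance-at w u {f} f∈E | yes refl | no _ | yes refl
        rewrite cut-antipode e∈E x moves w | cut-antipode e∈E x moves x | cut-antipode e∈E x moves x′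
              | cut-self e∈E x moves | cut-act e∈E x moves with cut e x w
      ...     | true  = refl
      ...     | false = refl
      balance-at w u {f} f∈E | yes refl | no u≢x | no u≢x̄ =
        cong (λ b → differ (cut e u w) b + 0) (cut-act-stable u u≢x u≢x̄)

    crossings-act-balance : ∀ w → crossings w x  + 2 * differ (cut e x w) true ≡
                                  crossings w x′ + 2 * differ (cut e x w) false
    crossings-act-balance w = begin
      crossings w x + 2 * k₁
        ≡⟨ cong (λ c → crossings w x + c * k₁) total-weight ⟨
      crossings w x + (∑[ u ∈ allWords m n ] ∑[ f ∈ E ] weight u f) * k₁
        ≡⟨ ∑∑-+-*ʳ _ _ k₁ ⟨
      ∑[ u ∈ allWords m n ] ∑[ f ∈ E ] (differ (cut f u w) (cut f u x) + weight u f * k₁)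
        ≡⟨ ∑-cong (allWords m n) (λ {u} _ → ∑-cong E (balance-at w u)) ⟩
      ∑[ u ∈ allWords m n ] ∑[ f ∈ E ] (differ (cut f u w) (cut f u x′) + weight u f * k₀)
        ≡⟨ ∑∑-+-*ʳ _ _ k₀ ⟩
      crossings w x′ + (∑[ u ∈ allWords m n ] ∑[ f ∈ E ] weight u f) * k₀
        ≡⟨ cong (λ c → crossings w x′ + c * k₀) total-weight ⟩
      crossings w x′ + 2 * k₀ ∎
      where
      open ≡-Reasoning
      k₁ = differ (cut e x w) true
      k₀ = differ (cut e x w) false
      ∑∑-+-*ʳ : ∀ (F G : Word m n → OEdge m → ℕ) k →
                ∑[ u ∈ allWords m n ] ∑[ f ∈ E ] (F u f + G u f * k) ≡
                ∑[ u ∈ allWords m n ] ∑[ f ∈ E ] F u f + (∑[ u ∈ allWords m n ] ∑[ f ∈ E ] G u f) * k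
      ∑∑-+-*ʳ F G k =
        trans (∑-cong (allWords m n) (λ {u} _ → ∑-+-*ʳ E (F u) (G u) k)) (∑-+-*ʳ (allWords m n) _ _ k)

    crossings-act-toward : ∀ w → cut e x w ≡ true → crossings w x ≡ crossings w x′ + 2
    crossings-act-toward w c = trans (sym (+-identityʳ _))
      (subst (λ b → crossings w x + 2 * differ b true ≡ crossings w x′ + 2 * differ b false) c (crossings-act-balance w))

    crossings-act-away : ∀ w → cut e x w ≡ false → crossings w x′ ≡ crossings w x + 2
    crossings-act-away w c = sym (trans
      (subst (λ b → crossings w x + 2 * differ b true ≡ crossings w x′ + 2 * differ b false) c (crossings-act-balance w))
      (+-identityʳ _))

  crossings-act-≤ : ∀ {e n} → e ∈ E → (x y : Word m n) →
                    crossings y x ≤ crossings y (act e x) + 2 × crossings y (act e x) ≤ crossings y x + 2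
  crossings-act-≤ {e} e∈E x y with half e x ≟ℕ 0
  ... | yes h≡0 rewrite half≡0⇒act≡ x h≡0 = m≤m+n _ 2 , m≤m+n _ 2
  ... | no h≢0 with cut e x y in c
  ...   | true  = ≤-reflexive toward , ≤-trans (m≤m+n _ 2) (≤-trans (≤-reflexive (sym toward)) (m≤m+n _ 2))
    where toward = crossings-act-toward e∈E x (n≢0⇒n>0 h≢0) y c
  ...   | false = ≤-trans (m≤m+n _ 2) (≤-trans (≤-reflexive (sym away)) (m≤m+n _ 2)) , ≤-reflexive away
    where away = crossings-act-away e∈E x (n≢0⇒n>0 h≢0) y c

  open Schreier E using (adj)

  adj-act : ∀ {e n} → e ∈ E → (x : Word m n) → adj n x (act e x) ≡ true
  adj-act {e} e∈E x = any-intro _ e∈E (cong (_∨ does (act e (act e x) ≟ʷ x)) (dec-true (act e x ≟ʷ act e x) refl))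

  adj-act⁻¹ : ∀ {e n} → e ∈ E → (x : Word m n) → adj n (act e x) x ≡ true
  adj-act⁻¹ {e} e∈E x = any-intro _ e∈E
    (trans (cong (does (act e (act e x) ≟ʷ x) ∨_) (dec-true (act e x ≟ʷ act e x) refl)) (∨-zeroʳ _))

  crossings-lipschitz : ∀ {n} {x x′ : Word m n} y → adj n x x′ ≡ true → crossings y x ≤ crossings y x′ + 2
  crossings-lipschitz {n} {x} {x′} y x~x′ with any-elim _ E x~x′
  ... | e , e∈E , acts with ∨-elim (does (act e x ≟ʷ x′)) acts
  ...   | inj₁ ex≡x′ rewrite sym (from-does (act e x ≟ʷ x′) ex≡x′) = proj₁ (crossings-act-≤ e∈E x y)
  ...   | inj₂ ex′≡x rewrite sym (from-does (act e x′ ≟ʷ x) ex′≡x) = proj₂ (crossings-act-≤ e∈E x′ y)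

  -- Step from x along the e-cycle towards the gate of y: forwards if the gate lies ahead of x,
  -- backwards otherwise.
  private
    module Descent {e n} (e∈E : e ∈ E) {x y : Word m n} (moves : gate e x y ≢ x) where
      x-moves : 0 < half e x
      x-moves = n≢0⇒n>0 (moves ∘ half≡0⇒gate≡ x y)

      q≢p : index e (gate e x y) ≢ index e x
      q≢p = moves ∘ index-injective (SameOrbit-sym (gate-SameOrbit x y))

      q<2L : index e (gate e x y) < half e x + half e x
      q<2L = index<2half e∈E (gate-SameOrbit x y) x-moves

      x⁻ = act⁻¹ e x

      back : act e x⁻ ≡ x
      back = act-act⁻¹ (proper e∈E) x

      x⁻~x : SameOrbit e x⁻ x
      x⁻~x = subst (SameOrbit e x⁻) back (SameOrbit-act x⁻)

      x⁻↦x : CyclicSuc (half e x + half e x) (index e x⁻) (index e x)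
      x⁻↦x = subst₂ (λ N r → CyclicSuc N (index e x⁻) r)
                    (trans (orbitSize-cong x⁻~x) (half>0⇒orbitSize≡2half x x-moves))
                    (cong (index e) back) (index-act (proper e∈E) x⁻)

      descend : ∃ λ x′ → adj n x x′ ≡ true × crossings y x ≡ crossings y x′ + 2
      descend with Ahead-or-¬Ahead-pred q<2L q≢p x⁻↦x
      ... | inj₁ ahead = act e x , adj-act e∈E x , crossings-act-toward e∈E x x-moves y (dec-true (ahead? _ _ _) ahead)
      ... | inj₂ ¬ahead =
        x⁻ , subst (λ z → adj n z x⁻ ≡ true) back (adj-act⁻¹ e∈E x⁻) ,
        subst (λ z → crossings y z ≡ crossings y x⁻ + 2) back
              (crossings-act-away e∈E x⁻ (subst (0 <_) (sym (half-cong x⁻~x)) x-moves) y x⁻-cut)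
        where
        x⁻-cut : cut e x⁻ y ≡ false
        x⁻-cut = trans (cong₂ (λ L o → ahead L (index e x⁻) (index e o)) (half-cong x⁻~x) (gate-cong y x⁻~x))
                       (dec-false (ahead? _ _ _) ¬ahead)

  crossings-descent : ∀ {n} {x y : Word m n} → x ≢ y →
                      ∃ λ x′ → adj n x x′ ≡ true × crossings y x ≡ crossings y x′ + 2
  crossings-descent {zero}  {[]} {[]} x≢y = contradiction refl x≢y
  crossings-descent {suc n} {x} {y} x≢y =
    let e , e∈E , _ , moves = moving-edge x y x≢y in Descent.descend e∈E moves

  private
    differ-cut≤ : ∀ {n} e (u x y : Word m (suc n)) → differ (cut e u x) (cut e u y) ≤ 𝟙 (incident? e (head u))
    differ-cut≤ e u x y with incident? e (head u)
    ... | yes _ = differ≤1 (cut e u x) (cut e u y)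
    ... | no ¬inc = ≤-reflexive (trans (cong₂ (λ o o′ → differ (cut-at o) (cut-at o′))
                                              (half≡0⇒gate≡ u x u-fixed) (half≡0⇒gate≡ u y u-fixed))
                                       (differ-refl _))
      where
      cut-at = λ o → ahead (half e u) (index e u) (index e o)
      u-fixed = ¬incident⇒half≡0 u ¬inc

    incident-words : ∀ {e} n → e ∈ E → ∑[ u ∈ allWords m (suc n) ] 𝟙 (incident? e (head u)) ≡ m ^ n * 2
    incident-words {e} n e∈E = begin
      ∑[ u ∈ allWords m (suc n) ] 𝟙 (incident? e (head u))
        ≡⟨ ∑-allWords n (λ u → 𝟙 (incident? e (head u))) ⟩
      ∑[ a ∈ allFin m ] ∑[ w ∈ allWords m n ] 𝟙 (incident? e a)
        ≡⟨ ∑-cong (allFin m) (λ {a} _ → trans (∑-const (allWords m n) _)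
                                              (cong (_* 𝟙 (incident? e a)) (length-allWords n))) ⟩
      ∑[ a ∈ allFin m ] (m ^ n * 𝟙 (incident? e a))
        ≡⟨ ∑-*ˡ (allFin m) (m ^ n) _ ⟩
      m ^ n * ∑[ a ∈ allFin m ] 𝟙 (incident? e a)
        ≡⟨ cong (m ^ n *_) (∑-cong (allFin m) (λ {a} _ → 𝟙-⊎ (a ≟ proj₁ e) (a ≟ proj₂ e)
                                                        (λ (a≡s , a≡t) → proper e∈E (trans (sym a≡s) a≡t)))) ⟩
      m ^ n * ∑[ a ∈ allFin m ] (𝟙 (a ≟ proj₁ e) + 𝟙 (a ≟ proj₂ e))
        ≡⟨ cong (m ^ n *_) (trans (∑-+ (allFin m) _ _)
                                  (cong₂ _+_ (∑-𝟙-allFin (proj₁ e)) (∑-𝟙-allFin (proj₂ e)))) ⟩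
      m ^ n * 2 ∎
      where open ≡-Reasoning

  crossings-bound : ∀ {n} (x y : Word m (suc n)) → crossings x y ≤ length E * (m ^ n * 2)
  crossings-bound {n} x y = begin
    crossings x y
      ≤⟨ ∑-mono-≤ (allWords m (suc n)) (λ {u} _ → ∑-mono-≤ E (λ {e} _ → differ-cut≤ e u x y)) ⟩
    ∑[ u ∈ allWords m (suc n) ] ∑[ e ∈ E ] 𝟙 (incident? e (head u))
      ≡⟨ ∑-swap (allWords m (suc n)) E _ ⟩
    ∑[ e ∈ E ] ∑[ u ∈ allWords m (suc n) ] 𝟙 (incident? e (head u))
      ≡⟨ ∑-cong E (incident-words n) ⟩
    ∑[ e ∈ E ] (m ^ n * 2)
      ≡⟨ ∑-const E _ ⟩
    length E * (m ^ n * 2) ∎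
    where open ≤-Reasoning

-- Distances and the Szeged index

module TwiceDistance {m : ℕ} (E : List (OEdge m)) (n : ℕ)
  (h : Word m n → Word m n → ℕ)
  (h-sym : ∀ x y → h x y ≡ h y x)
  (h-refl : ∀ x → h x x ≡ 0)
  (h-lipschitz : ∀ {x x′} y → Schreier.adj E n x x′ ≡ true → h y x ≤ h y x′ + 2)
  (h-descent : ∀ {x y} → x ≢ y → ∃ λ x′ → Schreier.adj E n x x′ ≡ true × h y x ≡ h y x′ + 2)
  where
  open Schreier E n

  h≡0⇒≡ : ∀ {x y} → h x y ≡ 0 → x ≡ y
  h≡0⇒≡ {x} {y} h≡0 with x ≟ʷ y
  ... | yes x≡y = x≡y
  ... | no x≢y  = let x′ , _ , eq = h-descent x≢y in
    contradiction (trans (sym (trans (h-sym x y) eq)) h≡0) (λ h′+2≡0 → m+1+n≢0 (h y x′) h′+2≡0)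

  within-sound : ∀ k {x y} → within k x y ≡ true → h x y ≤ k + k
  within-sound zero {x} {y} x==y rewrite from-does (x ≟ʷ y) x==y | h-refl y = z≤n
  within-sound (suc k) {x} {y} w with ∨-elim (within k x y) w
  ... | inj₁ w′ = ≤-trans (within-sound k w′) (+-mono-≤ (n≤1+n k) (n≤1+n k))
  ... | inj₂ w′ with any-elim _ V w′
  ...   | z , _ , adj∧within with ∧-elim (adj x z) adj∧within
  ...     | x~z , w″ = begin
    h x y          ≡⟨ h-sym x y ⟩
    h y x          ≤⟨ h-lipschitz y x~z ⟩
    h y z + 2      ≡⟨ cong (_+ 2) (h-sym y z) ⟩
    h z y + 2      ≤⟨ +-monoˡ-≤ 2 (within-sound k w″) ⟩
    k + k + 2      ≡⟨ double-suc k ⟨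
    suc k + suc k  ∎
    where open ≤-Reasoning

  within-complete : ∀ k {x y} → h x y ≤ k + k → within k x y ≡ true
  within-complete zero {x} {y} h≤0 rewrite h≡0⇒≡ (n≤0⇒n≡0 h≤0) = dec-true (y ≟ʷ y) refl
  within-complete (suc k) {x} {y} h≤ with h x y ≤? k + k
  ... | yes h≤′ rewrite within-complete k h≤′ = refl
  ... | no h≰ with x ≟ʷ y
  ...   | yes refl = contradiction (subst (_≤ k + k) (sym (h-refl x)) z≤n) h≰
  ...   | no x≢y = let x′ , x~x′ , eq = h-descent x≢y in
    trans (cong (within k x y ∨_) (any-intro _ (∈-allWords x′) (cong₂ _∧_ x~x′ (within-complete k (closer eq)) )))
          (∨-zeroʳ _)
    where
    closer : ∀ {x′} → h y x ≡ h y x′ + 2 → h x′ y ≤ k + k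
    closer {x′} eq = +-cancelʳ-≤ 2 (h x′ y) (k + k) (begin
      h x′ y + 2     ≡⟨ cong (_+ 2) (h-sym x′ y) ⟩
      h y x′ + 2     ≡⟨ eq ⟨
      h y x          ≡⟨ h-sym y x ⟩
      h x y          ≤⟨ h≤ ⟩
      suc k + suc k  ≡⟨ double-suc k ⟩
      k + k + 2      ∎)
      where open ≤-Reasoning

  h-even : ∀ b {x y} → h x y ≤ b → ∃ λ d → h x y ≡ d + d
  h-even b {x} {y} h≤b with x ≟ʷ y
  ... | yes refl = 0 , h-refl x
  h-even zero    h≤b | no x≢y = 0 , n≤0⇒n≡0 h≤b
  h-even (suc b) {x} {y} h≤b | no x≢y =
    let x′ , _ , eq = h-descent x≢y
        h′≡h+2 = trans (cong (_+ 2) (h-sym x′ y)) (sym (trans (h-sym x y) eq))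
        h′<h = subst (suc (h x′ y) ≤_) h′≡h+2 (m<m+n (h x′ y) (s≤s z≤n))
        d , h′≡2d = h-even b (≤-pred (≤-trans h′<h h≤b))
    in suc d , (begin
      h x y            ≡⟨ h′≡h+2 ⟨
      h x′ y + 2       ≡⟨ cong (_+ 2) h′≡2d ⟩
      d + d + 2        ≡⟨ double-suc d ⟨
      suc d + suc d    ∎)
    where open ≡-Reasoning

  least-≡ : ∀ fuel (p : ℕ → Bool) d → p d ≡ true → (∀ {k} → k < d → p k ≡ false) → d < fuel →
            least fuel p ≡ d
  least-≡ (suc f) p zero    pd _     _          rewrite pd = refl
  least-≡ (suc f) p (suc d) pd below (s≤s d<f) rewrite below {0} (s≤s z≤n) =
    cong suc (least-≡ f (p ∘ suc) d pd (below ∘ s≤s) d<f)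

  h≡2dist : ∀ x y → h x y < length V + length V → h x y ≡ dist x y + dist x y
  h≡2dist x y h<2V = trans h≡2d (cong (λ k → k + k) (sym dist≡d))
    where
    d = proj₁ (h-even (h x y) ≤-refl)
    h≡2d = proj₂ (h-even (h x y) ≤-refl)
    dist≡d : dist x y ≡ d
    dist≡d = least-≡ (length V) (λ k → within k x y) d
      (within-complete d (≤-reflexive h≡2d))
      (λ {k} k<d → ¬-not (λ w → <-irrefl refl (≤-<-trans (within-sound k w)
                                                  (subst (k + k <_) (sym h≡2d) (double-mono-< k<d)))))
      (≰⇒> (λ V≤d → <-irrefl refl (<-≤-trans h<2V
                                     (subst (length V + length V ≤_) (sym h≡2d) (+-mono-≤ V≤d V≤d)))))

module Szeged {m : ℕ} {E : List (OEdge m)} (S : SideFunction E) (E-unique : Unique E)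
              (edge-count : length E + 1 ≡ m) (n : ℕ) where
  open SideFunction S
  open Gates S
  open Cuts S
  open Crossings S E-unique
  open Schreier E (suc n)
  open TwiceDistance E (suc n) crossings crossings-sym crossings-refl crossings-lipschitz crossings-descent

  crossings≡2dist : ∀ x y → crossings x y ≡ dist x y + dist x y
  crossings≡2dist x y = h≡2dist x y (begin-strict
    crossings x y                                   ≤⟨ crossings-bound x y ⟩
    length E * (m ^ n * 2)                          ≡⟨ cong (length E *_) (*-comm (m ^ n) 2) ⟩
    length E * (m ^ n + (m ^ n + 0))                ≡⟨ *-distribˡ-+ (length E) (m ^ n) (m ^ n + 0) ⟩
    length E * m ^ n + length E * (m ^ n + 0)       ≡⟨ cong (λ k → length E * m ^ n + length E * k) (+-identityʳ (m ^ n)) ⟩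
    length E * m ^ n + length E * m ^ n             <⟨ +-mono-< (m<m+n (length E * m ^ n) m^n>0) (m<m+n (length E * m ^ n) m^n>0) ⟩
    (length E * m ^ n + m ^ n) + (length E * m ^ n + m ^ n) ≡⟨ cong (λ k → k + k) |V|≡ ⟨
    length V + length V                             ∎)
    where
    open ≤-Reasoning
    m>0 : 0 < m
    m>0 = subst (0 <_) (trans (+-comm 1 (length E)) edge-count) (s≤s z≤n)
    m^n>0 : 0 < m ^ n
    m^n>0 = m^n>0′ m {{>-nonZero m>0}} n
    |V|≡ : length V ≡ length E * m ^ n + m ^ n
    |V|≡ = begin-equality
      length V                    ≡⟨ length-allWords {m} (suc n) ⟩
      m * m ^ n                   ≡⟨ cong (_* m ^ n) edge-count ⟨
      (length E + 1) * m ^ n      ≡⟨ *-distribʳ-+ (m ^ n) (length E) 1 ⟩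
      length E * m ^ n + 1 * m ^ n ≡⟨ cong (length E * m ^ n +_) (*-identityˡ (m ^ n)) ⟩
      length E * m ^ n + m ^ n    ∎

  ∑-pairs-differ : ∀ {A : Set} (c : A → Bool) xs →
                   ∑[ p ∈ pairs xs ] differ (c (proj₁ p)) (c (proj₂ p)) ≡
                   (∑[ x ∈ xs ] differ (c x) true) * (∑[ x ∈ xs ] differ (c x) false)
  ∑-pairs-differ c []       = refl
  ∑-pairs-differ c (x ∷ xs) = begin
    ∑ (map (x ,_) xs ++ pairs xs) d                 ≡⟨ ∑-++ (map (x ,_) xs) (pairs xs) d ⟩
    ∑ (map (x ,_) xs) d + ∑ (pairs xs) d            ≡⟨ cong₂ _+_ (∑-map (x ,_) xs d) (∑-pairs-differ c xs) ⟩
    ∑[ y ∈ xs ] differ (c x) (c y) + F * T          ≡⟨ split (c x) ⟩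
    (differ (c x) true + F) * (differ (c x) false + T) ∎
    where
    open ≡-Reasoning
    d = λ p → differ (c (proj₁ p)) (c (proj₂ p))
    F = ∑[ y ∈ xs ] differ (c y) true
    T = ∑[ y ∈ xs ] differ (c y) false
    split : ∀ b → ∑[ y ∈ xs ] differ b (c y) + F * T ≡ (differ b true + F) * (differ b false + T)
    split true  = trans (cong (_+ F * T) (∑-cong xs (λ _ → differ-sym true _))) (sym (*-suc F T))
    split false = cong (_+ F * T) (∑-cong xs (λ _ → differ-sym false _))

  module _ {e} (e∈E : e ∈ E) {u : Word m (suc n)} (moves : 0 < half e u) where

    dist-act-away : ∀ w → cut e u w ≡ false → dist w (act e u) ≡ suc (dist w u)
    dist-act-away w c = double-injective _ _ (begin
      dist w (act e u) + dist w (act e u)   ≡⟨ crossings≡2dist w (act e u) ⟨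
      crossings w (act e u)                 ≡⟨ crossings-act-away e∈E u moves w c ⟩
      crossings w u + 2                     ≡⟨ cong (_+ 2) (crossings≡2dist w u) ⟩
      dist w u + dist w u + 2               ≡⟨ double-suc (dist w u) ⟨
      suc (dist w u) + suc (dist w u)       ∎)
      where open ≡-Reasoning

    dist-act-toward : ∀ w → cut e u w ≡ true → dist w u ≡ suc (dist w (act e u))
    dist-act-toward w c = double-injective _ _ (begin
      dist w u + dist w u                   ≡⟨ crossings≡2dist w u ⟨
      crossings w u                         ≡⟨ crossings-act-toward e∈E u moves w c ⟩
      crossings w (act e u) + 2             ≡⟨ cong (_+ 2) (crossings≡2dist w (act e u)) ⟩
      dist w (act e u) + dist w (act e u) + 2 ≡⟨ double-suc (dist w (act e u)) ⟨
      suc (dist w (act e u)) + suc (dist w (act e u)) ∎)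
      where open ≡-Reasoning

  nn≡∑differ : ∀ {u v} (c : Word m (suc n) → Bool) →
               (∀ w → c w ≡ false → dist w v ≡ suc (dist w u)) →
               (∀ w → c w ≡ true → dist w u ≡ suc (dist w v)) →
               nn u v ≡ ∑[ w ∈ V ] differ (c w) true
  nn≡∑differ {u} {v} c near-u near-v = trans (length-filter-∑ _ V) (∑-cong V (λ {w} _ → counted w))
    where
    counted : ∀ w → 𝟙 (dist w u <? dist w v) ≡ differ (c w) true
    counted w with c w in cw
    ... | false = 𝟙-yes (dist w u <? dist w v) (≤-reflexive (sym (near-u w cw)))
    ... | true  = 𝟙-no (dist w u <? dist w v) (λ lt → <-asym lt (≤-reflexive (sym (near-v w cw))))

  nn-product : ∀ {e} → e ∈ E → (u : Word m (suc n)) →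
               nn u (act e u) * nn (act e u) u ≡ ∑[ p ∈ pairs V ] differ (cut e u (proj₁ p)) (cut e u (proj₂ p))
  nn-product {e} e∈E u with half e u ≟ℕ 0
  ... | no h≢0 = begin
    nn u (act e u) * nn (act e u) u
      ≡⟨ cong₂ _*_ (nn≡∑differ (cut e u) (dist-act-away e∈E moves) (dist-act-toward e∈E moves))
                   (trans (nn≡∑differ (not ∘ cut e u) (λ w → dist-act-toward e∈E moves w ∘ not-injective)
                                                      (λ w → dist-act-away e∈E moves w ∘ not-injective))
                          (∑-cong V (λ {w} _ → differ-not (cut e u w)))) ⟩
    (∑[ w ∈ V ] differ (cut e u w) true) * (∑[ w ∈ V ] differ (cut e u w) false)
      ≡⟨ ∑-pairs-differ (cut e u) V ⟨
    ∑[ p ∈ pairs V ] differ (cut e u (proj₁ p)) (cut e u (proj₂ p)) ∎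
    where
    open ≡-Reasoning
    moves = n≢0⇒n>0 h≢0
  ... | yes h≡0 rewrite half≡0⇒act≡ u h≡0 = trans (cong (_* nn u u) nn-refl) (sym no-pair-separated)
    where
    nn-refl : nn u u ≡ 0
    nn-refl = trans (length-filter-∑ _ V)
                    (trans (∑-cong V (λ {w} _ → 𝟙-no (dist w u <? dist w u) (<-irrefl refl))) (∑-zero V))
    cut-const : ∀ z → cut e u z ≡ cut e u u
    cut-const z = cong (ahead (half e u) (index e u) ∘ index e)
                       (trans (half≡0⇒gate≡ u z h≡0) (sym (half≡0⇒gate≡ u u h≡0)))
    no-pair-separated : ∑[ p ∈ pairs V ] differ (cut e u (proj₁ p)) (cut e u (proj₂ p)) ≡ 0
    no-pair-separated = trans (∑-cong (pairs V) (λ {p} _ → trans (cong₂ differ (cut-const (proj₁ p)) (cut-const (proj₂ p)))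
                                                                  (differ-refl _)))
                              (∑-zero (pairs V))

  Sz≡2W : Sz ≡ 2 * W
  Sz≡2W = begin
    Sz
      ≡⟨ sum-map _ edges ⟩
    ∑[ p ∈ edges ] (nn (proj₁ p) (proj₂ p) * nn (proj₂ p) (proj₁ p))
      ≡⟨ ∑-concatMap _ V _ ⟩
    ∑[ u ∈ V ] ∑[ p ∈ map (λ e → (u , act e u)) E ] (nn (proj₁ p) (proj₂ p) * nn (proj₂ p) (proj₁ p))
      ≡⟨ ∑-cong V (λ {u} _ → ∑-map _ E _) ⟩
    ∑[ u ∈ V ] ∑[ e ∈ E ] (nn u (act e u) * nn (act e u) u)
      ≡⟨ ∑-cong V (λ {u} _ → ∑-cong E (λ e∈E → nn-product e∈E u)) ⟩
    ∑[ u ∈ V ] ∑[ e ∈ E ] ∑[ p ∈ pairs V ] separated u e p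
      ≡⟨ ∑-cong V (λ {u} _ → ∑-swap E (pairs V) (separated u)) ⟩
    ∑[ u ∈ V ] ∑[ p ∈ pairs V ] ∑[ e ∈ E ] separated u e p
      ≡⟨ ∑-swap V (pairs V) _ ⟩
    ∑[ p ∈ pairs V ] crossings (proj₁ p) (proj₂ p)
      ≡⟨ ∑-cong (pairs V) (λ {p} _ → crossings≡2dist (proj₁ p) (proj₂ p)) ⟩
    ∑[ p ∈ pairs V ] (dist (proj₁ p) (proj₂ p) + dist (proj₁ p) (proj₂ p))
      ≡⟨ ∑-+ (pairs V) _ _ ⟩
    ∑[ p ∈ pairs V ] dist (proj₁ p) (proj₂ p) + ∑[ p ∈ pairs V ] dist (proj₁ p) (proj₂ p)
      ≡⟨ cong (λ k → k + k) (sum-map _ (pairs V)) ⟨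
    W + W
      ≡⟨ cong (W +_) (+-identityʳ W) ⟨
    2 * W ∎
    where
    open ≡-Reasoning
    separated : Word m (suc n) → OEdge m → Word m (suc n) × Word m (suc n) → ℕ
    separated u e p = differ (cut e u (proj₁ p)) (cut e u (proj₂ p))

mainTheorem7 : (m : ℕ) (E : List (OEdge m)) → IsTree m E →
               (n : ℕ) → Schreier.Sz E (suc n) ≡ 2 * Schreier.W E (suc n)
mainTheorem7 m E tree n =
  Szeged.Sz≡2W (TreeSides.sideFunction tree) (TreeSides.E-unique tree) (IsTree.edgeCount tree) n
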